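{- For $j\ge 0$ define the permutation of $\{1,\dots,2j+5\}$ $$\alpha^{(j)}=2j+4,\ 3,\ \omega^{(j)},\ 1,\ 5,\ 2,$$ where $\omega^{(j)}=2j+2,\,2j+5,\,2j,\,2j+3,\,2j-2,\,2j+1,\,\dots,\,6,\,9,\,4,\,7$ is the concatenation of the pairs $(2i,\,2i+3)$ for $i=j+1,j,\dots,2$ (so $\omega^{(0)}$ is empty and $\alpha^{(0)}=43152$, $\alpha^{(1)}=6347152$, $\alpha^{(2)}=836947152$). Then $\{\alpha^{(j)}\}_{j\ge0}$ is an infinite antichain in the permutation pattern poset, no $\alpha^{(j)}$ is $2$-sortable, and each $\alpha^{(j)}$ is minimal with this property: removing any single entry of $\alpha^{(j)}$ (and standardizing) yields a $2$-sortable permutation.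
   Context: The $\mathfrak{D}^2\mathfrak{I}$ machine consists of two stacks $D_1,D_2$ in series whose elements must be in decreasing order from top to bottom (top is largest), followed by a stack $I$ whose elements must be in increasing order from top to bottom (top is smallest). The input permutation is read left to right. Operations: $d_0$: push the next input element into $D_1$; $d_1$: pop from $D_1$ and push into $D_2$; $d_2$: pop from $D_2$ and push into $I$; $d_3$: pop from $I$ and append to the output. An operation is legal if it respects the stack order restrictions ($d_3$ is considered legal if it outputs the smallest element not yet output or if no other operation is legal). A permutation $\pi$ of length $n$ is $2$-sortable if some sequence of legal operations produces the output $12\cdots n$. The permutation pattern poset orders permutations by pattern containment ($\sigma\le\pi$ if $\pi$ has a subsequence order-isomorphic to $\sigma$); an antichain is a set of pairwise incomparable elements. -}

module Defs where

open import Data.Nat using (ℕ; zero; suc; _+_; _*_; _≤_; _<_; _<?_)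
open import Data.List using (List; []; _∷_; _++_; [_]; map; length; filter; concatMap; downFrom; upTo)
open import Data.List.Relation.Unary.All using (All)
open import Data.List.Relation.Binary.Sublist.Propositional using (_⊆_)
open import Data.Product using (Σ; _×_; ∃; ∃-syntax)
open import Data.Sum using (_⊎_)
open import Data.Unit using (⊤)
open import Relation.Nullary using (¬_)
open import Relation.Binary.PropositionalEquality using (_≡_)
open import Relation.Binary.Construct.Closure.ReflexiveTransitive using (Star)

-- Permutations of {1,…,n} are represented as lists of naturals (one-line notation).

-- Standardization: replace each entry x by 1 + (number of entries smaller than x).
-- (For lists of distinct entries this is the order-isomorphic permutation of 1..n.)
std : List ℕ → List ℕ
std xs = map (λ x → suc (length (filter (_<? x) xs))) xs

_≼_ : List ℕ → List ℕ → Set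
σ ≼ π = ∃[ τ ] (τ ⊆ π × std τ ≡ σ)

idPerm : ℕ → List ℕ
idPerm n = map suc (upTo n)

-- The D²I machine.  Stacks are lists with the top at the head.

record State : Set where
  constructor st
  field
    input  : List ℕ
    D₁     : List ℕ
    D₂     : List ℕ
    I      : List ℕ
    output : List ℕ

open State public

-- "x may be pushed onto a stack whose elements are decreasing top to bottom"
-- (top is largest): stack empty or x larger than the top.
CanPushDec : ℕ → List ℕ → Set
CanPushDec x []      = ⊤
CanPushDec x (y ∷ _) = y < x

-- "x may be pushed onto a stack whose elements are increasing top to bottom"
-- (top is smallest): stack empty or x smaller than the top.
CanPushInc : ℕ → List ℕ → Set
CanPushInc x []      = ⊤
CanPushInc x (y ∷ _) = x < y

Legal₀ : State → Set
Legal₀ s = Σ ℕ λ x → Σ (List ℕ) λ rest → (input s ≡ x ∷ rest) × CanPushDec x (D₁ s)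

Legal₁ : State → Set
Legal₁ s = Σ ℕ λ x → Σ (List ℕ) λ rest → (D₁ s ≡ x ∷ rest) × CanPushDec x (D₂ s)

Legal₂ : State → Set
Legal₂ s = Σ ℕ λ x → Σ (List ℕ) λ rest → (D₂ s ≡ x ∷ rest) × CanPushInc x (I s)

data Step : State → State → Set where
  d₀ : ∀ {x inp d1 d2 i out} → CanPushDec x d1 →
       Step (st (x ∷ inp) d1 d2 i out) (st inp (x ∷ d1) d2 i out)
  d₁ : ∀ {x inp d1 d2 i out} → CanPushDec x d2 →
       Step (st inp (x ∷ d1) d2 i out) (st inp d1 (x ∷ d2) i out)
  d₂ : ∀ {x inp d1 d2 i out} → CanPushInc x i →
       Step (st inp d1 (x ∷ d2) i out) (st inp d1 d2 (x ∷ i) out)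
  -- d₃ is legal if it outputs the smallest element not yet output
  -- (i.e. x is ≤ every element still in the machine or the input),
  -- or if no other operation is legal.
  d₃ : ∀ {x inp d1 d2 i out} →
       (All (x ≤_) (inp ++ d1 ++ d2 ++ i)
         ⊎ (¬ Legal₀ (st inp d1 d2 (x ∷ i) out)
            × ¬ Legal₁ (st inp d1 d2 (x ∷ i) out)
            × ¬ Legal₂ (st inp d1 d2 (x ∷ i) out))) →
       Step (st inp d1 d2 (x ∷ i) out) (st inp d1 d2 i (out ++ [ x ]))

initial : List ℕ → State
initial π = st π [] [] [] []

Sortable₂ : List ℕ → Set
Sortable₂ π = Σ State λ s → Star Step (initial π) s × output s ≡ idPerm (length π)

ω : ℕ → List ℕ
ω j = concatMap (λ i → 2 * i ∷ 2 * i + 3 ∷ []) (map (2 +_) (downFrom j))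

α : ℕ → List ℕ
α j = (2 * j + 4) ∷ 3 ∷ (ω j ++ (1 ∷ 5 ∷ 2 ∷ []))

-- 1. Strict runs compare a moved entry with its whole target stack and only
--    output the least remaining entry.  They are legal runs, make sense for
--    arbitrary distinct values, survive relabelling by ranks (strict
--    sortability of ρ gives 2-sortability of std ρ) and deleting entries
--    (strict sortability passes to subsequences).
-- 2. Antichain criterion: if the members have distinct lengths, are not
--    2-sortable, and all their one-point deletions are strictly sortable,
--    no member is a pattern of another, since a proper pattern of α(j) lies
--    in a one-point deletion of α(j).
-- 3. Levels: α(m+1) is read window by window; at level m the pair
--    (2m+4, 2m+7) of ω is the abstract word 1 4, and large entries that no
--    longer interact are parked at the bottom of I.
-- 4. Non-sortability: a finite set of abstract states, closed under all
--    legal moves up to this relabelling, shows that every legal run on α(j)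
--    misplaces an output entry or outputs at most one entry.
-- 5. Sortability of deletions: finite tables of strict runs for abstract
--    boundary configurations, chained by induction on the level.
module Submission where

open import Defs
open import Data.Bool using (Bool; true; false; T; _∧_; if_then_else_)
open import Data.Bool.Properties using (T-∧; T-≡)
open import Data.Empty using (⊥-elim)
open import Data.Fin as Fin using (Fin)
open import Data.Fin.Patterns using (0F; 1F; 2F; 3F; 4F)
open import Data.List using (List; []; _∷_; _++_; [_]; map; length; filter; removeAt;
  applyUpTo; take; drop; takeWhile; dropWhile)
open import Data.Bool.ListAction using (all; any)
open import Data.List.Properties using (∷-injectiveʳ; takeWhile++dropWhile; map-id; map-cong;
  ++-assoc; ++-identityʳ; map-++; length-map; map-∘; map-upTo; map-cong-local; filter-accept;
  filter-reject; filter-none; filter-++)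
open import Data.List.Membership.Propositional using (_∈_; find)
open import Data.List.Membership.Propositional.Properties using (∈-++⁺ˡ; ∈-++⁺ʳ)
open import Data.List.Relation.Binary.Permutation.Propositional using (_↭_; ↭-sym; ↭-trans; ↭-refl; ↭⇒↭ₛ)
open import Data.List.Relation.Binary.Permutation.Propositional.Properties using (shift; ++⁺ˡ;
  All-resp-↭; ∈-resp-↭; filter-↭; ↭-length)
import Data.List.Relation.Binary.Permutation.Setoid.Properties as SetoidPerm
open import Data.List.Relation.Binary.Sublist.Propositional using (_⊆_; []; _∷_; _∷ʳ_)
open import Data.List.Relation.Binary.Sublist.Heterogeneous.Properties using (length-mono-≤)
open import Data.List.Relation.Unary.All as All using (All; []; _∷_; all?)
open import Data.List.Relation.Unary.All.Properties using (++⁺; ++⁻ˡ; ++⁻ʳ; ∷ʳ⁺; filter⁺; map⁺; all⁺)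
open import Data.List.Relation.Unary.AllPairs using (AllPairs; []; _∷_; allPairs?)
import Data.List.Relation.Unary.AllPairs as AllPairs
import Data.List.Relation.Unary.AllPairs.Properties as AllPairsP
open import Data.List.Relation.Unary.Any using (here; there)
import Data.List.Relation.Unary.Any as Any
open import Data.List.Relation.Unary.Any.Properties using (any⁻)
open import Data.Nat as Nat using (ℕ; zero; suc; _+_; _*_; _≤_; _<_; _<?_; _≤?_; z≤n; s≤s; s≤s⁻¹;
  _<ᵇ_; _≤ᵇ_; _≡ᵇ_)
open import Data.Nat.Properties using (<ᵇ⇒<; <⇒<ᵇ; ≡ᵇ⇒≡; ≤⇒≤ᵇ; ≤ᵇ⇒≤; ≡⇒≡ᵇ; +-identityʳ; +-suc;
  ≤-refl; ≤-trans; +-comm; +-assoc; *-monoʳ-≤; m≤m+n; +-monoʳ-<; <⇒≱; ≮⇒≥; <⇒≤; <-irrefl; <⇒≯;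
  <-≤-trans; <-trans; m≤n⇒m≤1+n; m≤n⇒m<n∨m≡n; +-cancelˡ-≡; *-cancelˡ-≡; *-suc)
open import Data.List.Membership.DecPropositional Nat._≟_ using (_∈?_)
open import Data.Maybe using (Maybe; just; nothing)
open import Data.Product using (Σ; _×_; _,_; proj₁; proj₂)
open import Data.Sum using (_⊎_; inj₁; inj₂)
open import Data.Unit using (tt)
open import Function using (_∘_; id; Equivalence)
open import Relation.Binary.Construct.Closure.ReflexiveTransitive using (Star; ε; _◅_; _◅◅_; kleisliStar)
import Relation.Binary.Construct.Closure.ReflexiveTransitive as Star
open import Relation.Binary.PropositionalEquality using (_≡_; _≢_; refl; sym; trans; cong; cong₂;
  subst; resp₂; setoid; module ≡-Reasoning)
open import Relation.Nullary using (¬_; yes; no)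
open import Relation.Nullary.Decidable using (⌊_⌋; toWitness; _×-dec_)
open import Relation.Unary using (Pred; Decidable)

remaining : State → List ℕ
remaining s = input s ++ D₁ s ++ D₂ s ++ I s

-- Unlike legal runs, strict runs survive deleting entries and relabelling
-- values monotonically, and they make sense for lists of arbitrary values.
data StrictStep : State → State → Set where
  s₀ : ∀ {x inp d1 d2 i out} → All (_< x) d1 →
       StrictStep (st (x ∷ inp) d1 d2 i out) (st inp (x ∷ d1) d2 i out)
  s₁ : ∀ {x inp d1 d2 i out} → All (_< x) d2 →
       StrictStep (st inp (x ∷ d1) d2 i out) (st inp d1 (x ∷ d2) i out)
  s₂ : ∀ {x inp d1 d2 i out} → All (x <_) i →
       StrictStep (st inp d1 (x ∷ d2) i out) (st inp d1 d2 (x ∷ i) out)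
  s₃ : ∀ {x inp d1 d2 i out} → All (x <_) (inp ++ d1 ++ d2 ++ i) →
       StrictStep (st inp d1 d2 (x ∷ i) out) (st inp d1 d2 i (out ++ [ x ]))

Completes : State → Set
Completes s = Σ (List ℕ) λ o → Star StrictStep s (st [] [] [] [] o)

StrictlySortable : List ℕ → Set
StrictlySortable ρ = Completes (initial ρ)

canPushDec : ∀ {x d} → All (_< x) d → CanPushDec x d
canPushDec []        = tt
canPushDec (y<x ∷ _) = y<x

canPushInc : ∀ {x d} → All (x <_) d → CanPushInc x d
canPushInc []        = tt
canPushInc (x<y ∷ _) = x<y

strict⇒legal : ∀ {s t} → StrictStep s t → Step s t
strict⇒legal (s₀ p) = d₀ (canPushDec p)
strict⇒legal (s₁ p) = d₁ (canPushDec p)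
strict⇒legal (s₂ p) = d₂ (canPushInc p)
strict⇒legal (s₃ p) = d₃ (inj₁ (All.map <⇒≤ p))

record RunInvariant (ρ : List ℕ) (s : State) : Set where
  field
    conserved  : ρ ↭ output s ++ remaining s
    increasing : AllPairs _<_ (output s)
    belowRest  : All (λ y → All (y <_) (remaining s)) (output s)
open RunInvariant

moveEntry : ∀ {ρ out a b c d a′ b′ c′ d′} → a ++ b ++ c ++ d ↭ a′ ++ b′ ++ c′ ++ d′ →
            RunInvariant ρ (st a b c d out) → RunInvariant ρ (st a′ b′ c′ d′ out)
moveEntry {out = out} p inv = record
  { conserved  = ↭-trans (conserved inv) (++⁺ˡ out p)
  ; increasing = increasing inv
  ; belowRest  = All.map (All-resp-↭ p) (belowRest inv) }

popFront : (x : ℕ) (inp d1 d2 i : List ℕ) → inp ++ d1 ++ d2 ++ x ∷ i ↭ x ∷ inp ++ d1 ++ d2 ++ i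
popFront x inp d1 d2 i = reassociate (shift x (inp ++ d1 ++ d2) i)
  where
  reassoc : ∀ j → (inp ++ d1 ++ d2) ++ j ≡ inp ++ d1 ++ d2 ++ j
  reassoc j = trans (++-assoc inp (d1 ++ d2) j) (cong (inp ++_) (++-assoc d1 d2 j))
  reassociate : (inp ++ d1 ++ d2) ++ x ∷ i ↭ x ∷ (inp ++ d1 ++ d2) ++ i → inp ++ d1 ++ d2 ++ x ∷ i ↭ x ∷ inp ++ d1 ++ d2 ++ i
  reassociate p rewrite reassoc (x ∷ i) | reassoc i = p

invariant-step : ∀ {ρ s t} → StrictStep s t → RunInvariant ρ s → RunInvariant ρ t
invariant-step (s₀ {x} {inp} {d1} {d2} {i} _) = moveEntry (↭-sym (shift x inp (d1 ++ d2 ++ i)))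
invariant-step (s₁ {x} {inp} {d1} {d2} {i} _) = moveEntry (++⁺ˡ inp (↭-sym (shift x d1 (d2 ++ i))))
invariant-step (s₂ {x} {inp} {d1} {d2} {i} _) = moveEntry (++⁺ˡ inp (++⁺ˡ d1 (↭-sym (shift x d2 i))))
invariant-step {ρ} (s₃ {x} {inp} {d1} {d2} {i} {out} x<rest) inv = record
  { conserved  = subst (ρ ↭_) (sym (++-assoc out [ x ] _)) (↭-trans (conserved inv) (++⁺ˡ out pop))
  ; increasing = AllPairsP.++⁺ (increasing inv) ([] ∷ [])
                   (All.map (λ y<rest → All.lookup y<rest x∈rest ∷ []) (belowRest inv))
  ; belowRest  = ∷ʳ⁺ (All.map (λ y<rest → All.tail (All-resp-↭ pop y<rest)) (belowRest inv)) x<rest }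
  where
  pop = popFront x inp d1 d2 i
  x∈rest : x ∈ inp ++ d1 ++ d2 ++ x ∷ i
  x∈rest = ∈-resp-↭ (↭-sym pop) (here refl)

invariant-run : ∀ {ρ s t} → Star StrictStep s t → RunInvariant ρ s → RunInvariant ρ t
invariant-run ε          inv = inv
invariant-run (step ◅ r) inv = invariant-run r (invariant-step step inv)

invariant-initial : ∀ ρ → RunInvariant ρ (initial ρ)
invariant-initial ρ = record { conserved = subst (ρ ↭_) (sym (++-identityʳ ρ)) ↭-refl ; increasing = [] ; belowRest = [] }

completed-output : ∀ {ρ o} → Star StrictStep (initial ρ) (st [] [] [] [] o) → ρ ↭ o × AllPairs _<_ o
completed-output {ρ} {o} run = subst (ρ ↭_) (++-identityʳ o) (conserved inv) , increasing inv
  where inv = invariant-run run (invariant-initial ρ)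

-- rank ρ x = 1 + (number of entries of ρ below x); std ρ is map (rank ρ) ρ.
rank : List ℕ → ℕ → ℕ
rank ρ x = suc (length (filter (_<? x) ρ))

rank-cons-< : ∀ {z x} ρ → z < x → rank (z ∷ ρ) x ≡ suc (rank ρ x)
rank-cons-< ρ z<x = cong (suc ∘ length) (filter-accept (_<? _) z<x)

rank-cons-≮ : ∀ {z x} ρ → ¬ z < x → rank (z ∷ ρ) x ≡ rank ρ x
rank-cons-≮ ρ z≮x = cong (suc ∘ length) (filter-reject (_<? _) z≮x)

rank-mono : ∀ ρ {y x} → y ≤ x → rank ρ y ≤ rank ρ x
rank-mono []      y≤x = s≤s z≤n
rank-mono (z ∷ ρ) {y} {x} y≤x with z <? y | z <? x
... | yes z<y | yes z<x rewrite rank-cons-< ρ z<y | rank-cons-< ρ z<x = s≤s (rank-mono ρ y≤x)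
... | yes z<y | no  z≮x = ⊥-elim (z≮x (<-≤-trans z<y y≤x))
... | no  z≮y | yes z<x rewrite rank-cons-≮ ρ z≮y | rank-cons-< ρ z<x = m≤n⇒m≤1+n (rank-mono ρ y≤x)
... | no  z≮y | no  z≮x rewrite rank-cons-≮ ρ z≮y | rank-cons-≮ ρ z≮x = rank-mono ρ y≤x

rank-strict : ∀ ρ {y x} → y ∈ ρ → y < x → rank ρ y < rank ρ x
rank-strict (y ∷ ρ) (here refl) y<x
  rewrite rank-cons-≮ {y} {y} ρ (<-irrefl refl) | rank-cons-< ρ y<x = s≤s (rank-mono ρ (<⇒≤ y<x))
rank-strict (z ∷ ρ) {y} {x} (there y∈ρ) y<x with z <? y | z <? x
... | yes z<y | yes z<x rewrite rank-cons-< ρ z<y | rank-cons-< ρ z<x = s≤s (rank-strict ρ y∈ρ y<x)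
... | yes z<y | no  z≮x = ⊥-elim (z≮x (<-trans z<y y<x))
... | no  z≮y | yes z<x rewrite rank-cons-≮ ρ z≮y | rank-cons-< ρ z<x = m≤n⇒m≤1+n (rank-strict ρ y∈ρ y<x)
... | no  z≮y | no  z≮x rewrite rank-cons-≮ ρ z≮y | rank-cons-≮ ρ z≮x = rank-strict ρ y∈ρ y<x

rank-↭ : ∀ {ρ σ} x → ρ ↭ σ → rank ρ x ≡ rank σ x
rank-↭ x p = cong suc (↭-length (filter-↭ (_<? x) p))

rank-increasing : ∀ o → AllPairs _<_ o → map (rank o) o ≡ idPerm (length o)
rank-increasing []      []             = refl
rank-increasing (y ∷ o) (y<o ∷ inc-o) = begin
    rank (y ∷ o) y ∷ map (rank (y ∷ o)) o
  ≡⟨ cong₂ _∷_ rank-least (map-cong-local (All.map (rank-cons-< o) y<o)) ⟩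
    1 ∷ map (suc ∘ rank o) o
  ≡⟨ cong (1 ∷_) (map-∘ o) ⟩
    1 ∷ map suc (map (rank o) o)
  ≡⟨ cong (λ r → 1 ∷ map suc r) (rank-increasing o inc-o) ⟩
    1 ∷ map suc (idPerm (length o))
  ≡⟨ cong (λ r → 1 ∷ map suc r) (map-upTo suc (length o)) ⟩
    idPerm (suc (length o)) ∎
  where
  open ≡-Reasoning
  rank-least : rank (y ∷ o) y ≡ 1
  rank-least = trans (rank-cons-≮ o (<-irrefl refl)) (cong (suc ∘ length) (filter-none (_<? y) (All.map <⇒≯ y<o)))

mapState : (ℕ → ℕ) → State → State
mapState f (st a b c d e) = st (map f a) (map f b) (map f c) (map f d) (map f e)

module _ (ρ : List ℕ) where

  private
    r = rank ρ

  ranks-below : ∀ {x ys} → All (_∈ ρ) ys → All (_< x) ys → All (_< r x) (map r ys)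
  ranks-below []          []          = []
  ranks-below (y∈ ∷ ys∈) (y<x ∷ ys<x) = rank-strict ρ y∈ y<x ∷ ranks-below ys∈ ys<x

  ranks-above : ∀ {x ys} → x ∈ ρ → All (x <_) ys → All (r x <_) (map r ys)
  ranks-above x∈ []          = []
  ranks-above x∈ (x<y ∷ x<ys) = rank-strict ρ x∈ x<y ∷ ranks-above x∈ x<ys

  map-remaining : ∀ (a b c d : List ℕ) → map r (a ++ b ++ c ++ d) ≡ map r a ++ map r b ++ map r c ++ map r d
  map-remaining a b c d rewrite map-++ r a (b ++ c ++ d) | map-++ r b (c ++ d) | map-++ r c d = refl

  rank-step : ∀ {s t} → StrictStep s t → All (_∈ ρ) (remaining s) → StrictStep (mapState r s) (mapState r t)
  rank-step (s₀ {inp = inp} {d1} p) (_ ∷ rest∈) = s₀ (ranks-below (++⁻ˡ d1 (++⁻ʳ inp rest∈)) p)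
  rank-step (s₁ {x} {inp} {d1} {d2} p) rest∈ = s₁ (ranks-below (++⁻ˡ d2 (++⁻ʳ (x ∷ d1) (++⁻ʳ inp rest∈))) p)
  rank-step (s₂ {inp = inp} {d1} p) rest∈ with ++⁻ʳ d1 (++⁻ʳ inp rest∈)
  ... | x∈ ∷ _ = s₂ (ranks-above x∈ p)
  rank-step (s₃ {x} {inp} {d1} {d2} {i} {out} p) rest∈ with ++⁻ʳ d2 (++⁻ʳ d1 (++⁻ʳ inp rest∈))
  ... | x∈ ∷ _ rewrite map-++ r out [ x ] =
    s₃ (subst (All (r x <_)) (map-remaining inp d1 d2 i) (ranks-above x∈ p))

  rank-run : ∀ {s t} → Star StrictStep s t → RunInvariant ρ s → Star StrictStep (mapState r s) (mapState r t)
  rank-run ε          inv = ε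
  rank-run {s} (step ◅ run) inv = rank-step step rest∈ρ ◅ rank-run run (invariant-step step inv)
    where
    rest∈ρ : All (_∈ ρ) (remaining s)
    rest∈ρ = All.tabulate (λ y∈ → ∈-resp-↭ (↭-sym (conserved inv)) (∈-++⁺ʳ (output s) y∈))

strict⇒sortable₂ : ∀ ρ → StrictlySortable ρ → Sortable₂ (std ρ)
strict⇒sortable₂ ρ (o , run) =
  st [] [] [] [] (map (rank ρ) o) , Star.map strict⇒legal (rank-run ρ run (invariant-initial ρ)) , sorted
  where
  ρ↭o = proj₁ (completed-output run)
  sorted : map (rank ρ) o ≡ idPerm (length (std ρ))
  sorted = begin
      map (rank ρ) o              ≡⟨ map-cong-local (All.tabulate {xs = o} λ {x} _ → rank-↭ x ρ↭o) ⟩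
      map (rank o) o              ≡⟨ rank-increasing o (proj₂ (completed-output run)) ⟩
      idPerm (length o)           ≡⟨ cong idPerm (sym (↭-length ρ↭o)) ⟩
      idPerm (length ρ)           ≡⟨ cong idPerm (sym (length-map (rank ρ) ρ)) ⟩
      idPerm (length (std ρ))     ∎
    where open ≡-Reasoning

-- Deleting all entries outside a decidable set P from a strict run leaves a
-- strict run: the moves of deleted entries become idle.
module Restrict {p} {P : Pred ℕ p} (P? : Decidable P) where

  keep : List ℕ → List ℕ
  keep = filter P?

  restrictState : State → State
  restrictState (st a b c d e) = st (keep a) (keep b) (keep c) (keep d) (keep e)

  keep-remaining : ∀ a b c d → keep (a ++ b ++ c ++ d) ≡ keep a ++ keep b ++ keep c ++ keep d
  keep-remaining a b c d rewrite filter-++ P? a (b ++ c ++ d) | filter-++ P? b (c ++ d) | filter-++ P? c d = refl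

  restrict-step : ∀ {s t} → StrictStep s t → Star StrictStep (restrictState s) (restrictState t)
  restrict-step (s₀ {x} p) with P? x
  ... | yes Px = s₀ (filter⁺ P? p) ◅ ε
  ... | no ¬Px = ε
  restrict-step (s₁ {x} p) with P? x
  ... | yes Px = s₁ (filter⁺ P? p) ◅ ε
  ... | no ¬Px = ε
  restrict-step (s₂ {x} p) with P? x
  ... | yes Px = s₂ (filter⁺ P? p) ◅ ε
  ... | no ¬Px = ε
  restrict-step (s₃ {x} {inp} {d1} {d2} {i} {out} p) with P? x
  ... | yes Px rewrite filter-++ P? out [ x ] | filter-accept P? {xs = []} Px =
    s₃ (subst (All (x <_)) (keep-remaining inp d1 d2 i) (filter⁺ P? p)) ◅ ε
  ... | no ¬Px rewrite filter-++ P? out [ x ] | filter-reject P? {xs = []} ¬Px | ++-identityʳ (keep out) = ε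

  restrict : ∀ {ρ} → StrictlySortable ρ → StrictlySortable (keep ρ)
  restrict (o , run) = keep o , kleisliStar restrictState restrict-step run

strict⇒distinct : ∀ {ρ} → StrictlySortable ρ → AllPairs _≢_ ρ
strict⇒distinct (o , run) with completed-output run
... | ρ↭o , increasing-o = SetoidPerm.AllPairs-resp-↭ (setoid ℕ) (λ x≢y → x≢y ∘ sym) (resp₂ _≢_) (↭⇒↭ₛ (↭-sym ρ↭o))
                             (AllPairs.map (λ x<y x≡y → <-irrefl x≡y x<y) increasing-o)

⊆-∈ : ∀ {y : ℕ} {τ ρ} → τ ⊆ ρ → y ∈ τ → y ∈ ρ
⊆-∈ (_ ∷ʳ τ⊆ρ)    y∈τ         = there (⊆-∈ τ⊆ρ y∈τ)
⊆-∈ (refl ∷ τ⊆ρ) (here y≡)   = here y≡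
⊆-∈ (refl ∷ τ⊆ρ) (there y∈τ) = there (⊆-∈ τ⊆ρ y∈τ)

filter-agree : ∀ {p q} {P : Pred ℕ p} {Q : Pred ℕ q} (P? : Decidable P) (Q? : Decidable Q) {xs} →
               All (λ z → (P z → Q z) × (Q z → P z)) xs → filter P? xs ≡ filter Q? xs
filter-agree P? Q? [] = refl
filter-agree P? Q? {z ∷ xs} ((P⇒Q , Q⇒P) ∷ agree) with P? z
... | yes Pz rewrite filter-accept Q? {xs = xs} (P⇒Q Pz) = cong (z ∷_) (filter-agree P? Q? agree)
... | no ¬Pz rewrite filter-reject Q? {xs = xs} (¬Pz ∘ Q⇒P) = filter-agree P? Q? agree

select-sublist : ∀ {τ ρ} → AllPairs _≢_ ρ → τ ⊆ ρ → filter (_∈? τ) ρ ≡ τ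
select-sublist [] [] = refl
select-sublist {τ} (y≢ρ ∷ distinct) (y ∷ʳ τ⊆ρ) =
  trans (filter-reject (_∈? τ) (λ y∈τ → All.lookup y≢ρ (⊆-∈ τ⊆ρ y∈τ) refl)) (select-sublist distinct τ⊆ρ)
select-sublist {y ∷ τ} (y≢ρ ∷ distinct) (refl ∷ τ⊆ρ) =
  trans (filter-accept (_∈? (y ∷ τ)) (here refl))
        (cong (y ∷_) (trans (filter-agree (_∈? (y ∷ τ)) (_∈? τ) (All.map drop-y y≢ρ)) (select-sublist distinct τ⊆ρ)))
  where
  drop-y : ∀ {z} → y ≢ z → (z ∈ y ∷ τ → z ∈ τ) × (z ∈ τ → z ∈ y ∷ τ)
  drop-y y≢z = (λ { (here z≡y) → ⊥-elim (y≢z (sym z≡y)) ; (there z∈τ) → z∈τ }) , there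

strict-sublist : ∀ {τ ρ} → StrictlySortable ρ → τ ⊆ ρ → StrictlySortable τ
strict-sublist {τ} {ρ} sortable τ⊆ρ =
  subst StrictlySortable (select-sublist (strict⇒distinct sortable) τ⊆ρ) (Restrict.restrict (_∈? τ) sortable)

proper-sublist : ∀ {τ ρ : List ℕ} → τ ⊆ ρ → length τ < length ρ → Σ (Fin (length ρ)) λ k → τ ⊆ removeAt ρ k
proper-sublist (y ∷ʳ τ⊆ρ)    _             = Fin.zero , τ⊆ρ
proper-sublist (refl ∷ τ⊆ρ) (s≤s shorter) with proper-sublist τ⊆ρ shorter
... | k , τ⊆ρ-k = Fin.suc k , (refl ∷ τ⊆ρ-k)

-- A pattern of π_j of smaller length sits in some one-point
-- deletion of π_j, hence would be 2-sortable itself.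
antichain-criterion : (π : ℕ → List ℕ) →
  (∀ i j → length (π i) ≡ length (π j) → i ≡ j) →
  (∀ j → ¬ Sortable₂ (π j)) →
  (∀ j (k : Fin (length (π j))) → StrictlySortable (removeAt (π j) k)) →
  ∀ i j → i ≢ j → ¬ (π i ≼ π j)
antichain-criterion π length-injective unsortable deletions-sortable i j i≢j (τ , τ⊆πj , stdτ≡πi)
  with m≤n⇒m<n∨m≡n (length-mono-≤ τ⊆πj)
... | inj₂ same-length = i≢j (length-injective i j (trans (sym |τ|≡|πi|) same-length))
  where
  |τ|≡|πi| : length τ ≡ length (π i)
  |τ|≡|πi| = trans (sym (length-map _ τ)) (cong length stdτ≡πi)
... | inj₁ shorter with proper-sublist τ⊆πj shorter
... | k , τ⊆deletion =
  unsortable i (subst Sortable₂ stdτ≡πi (strict⇒sortable₂ τ (strict-sublist (deletions-sortable j k) τ⊆deletion)))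

record AState : Set where
  constructor as
  field ain a₁ a₂ aI aout : List ℕ
open AState

-- Concretisation through a labelling v, with concrete unread input `rest`
-- after the abstract input and parked entries B below the abstract part of I.
conc : (ℕ → ℕ) → List ℕ → List ℕ → AState → State
conc v rest B (as i d1 d2 L o) = st (map v i ++ rest) (map v d1) (map v d2) (map v L ++ B) (map v o)

st-cong : ∀ {a b c d e a′ b′ c′ d′ e′} → a ≡ a′ → b ≡ b′ → c ≡ c′ → d ≡ d′ → e ≡ e′ →
          st a b c d e ≡ st a′ b′ c′ d′ e′
st-cong refl refl refl refl refl = refl

split : ∀ x y → T (x ∧ y) → T x × T y
split x y = Equivalence.to T-∧

T-true : ∀ {b} → b ≡ true → T b
T-true = Equivalence.from T-≡

holds : ∀ {A : Set} (p : A → Bool) S {a} → T (all p S) → a ∈ S → T (p a)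
holds p S valid a∈S = All.lookup (all⁺ p S valid) a∈S

_==_ : List ℕ → List ℕ → Bool
[]       == []       = true
(x ∷ xs) == (y ∷ ys) = (x ≡ᵇ y) ∧ (xs == ys)
_        == _        = false

==-sound : ∀ xs ys → T (xs == ys) → xs ≡ ys
==-sound []       []       _    = refl
==-sound (x ∷ xs) (y ∷ ys) same = cong₂ _∷_ (≡ᵇ⇒≡ x y (proj₁ heads)) (==-sound xs ys (proj₂ heads))
  where heads = split (x ≡ᵇ y) (xs == ys) same

sameState : AState → AState → Bool
sameState (as a b c d e) (as a′ b′ c′ d′ e′) = (a == a′) ∧ ((b == b′) ∧ ((c == c′) ∧ ((d == d′) ∧ (e == e′))))

sameState-sound : ∀ a b → T (sameState a b) → a ≡ b
sameState-sound (as a b c d e) (as a′ b′ c′ d′ e′) same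
  with split (a == a′) _ same
... | sa , rest₁ with split (b == b′) _ rest₁
... | sb , rest₂ with split (c == c′) _ rest₂
... | sc , rest₃ with split (d == d′) (e == e′) rest₃
... | sd , se rewrite ==-sound a a′ sa | ==-sound b b′ sb | ==-sound c c′ sc | ==-sound d d′ sd | ==-sound e e′ se = refl

_∈ᵇ_ : AState → List AState → Bool
a ∈ᵇ S = any (sameState a) S

∈ᵇ-sound : ∀ {a} S → T (a ∈ᵇ S) → a ∈ S
∈ᵇ-sound {a} S a∈S = Any.map (sameState-sound a _) (any⁻ (sameState a) S a∈S)

-- Levels.  At level m the letter 0 stands for the value 3 and the letter
-- c+1 for 2m+4+c, so that the window pair (2m+4, 2m+7) of ω is the word 1 4.

label : ℕ → ℕ → ℕ
label m zero    = 3
label m (suc c) = 2 * (2 + m) + c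

-- The same value is named by a letter two larger one level further down.
shiftLetter : ℕ → ℕ
shiftLetter zero    = zero
shiftLetter (suc c) = 3 + c

label-shift : ∀ m c → label m (shiftLetter c) ≡ label (suc m) c
label-shift m zero    = refl
label-shift m (suc c) = sym (begin
  2 * (3 + m) + c        ≡⟨ cong (_+ c) (*-suc 2 (2 + m)) ⟩
  2 + 2 * (2 + m) + c    ≡⟨ cong (_+ c) (+-comm 2 (2 * (2 + m))) ⟩
  2 * (2 + m) + 2 + c    ≡⟨ +-assoc (2 * (2 + m)) 2 c ⟩
  2 * (2 + m) + (2 + c)  ∎)
  where open ≡-Reasoning

four≤label : ∀ m c → 4 ≤ label m (suc c)
four≤label m c = ≤-trans (*-monoʳ-≤ 2 (m≤m+n 2 m)) (m≤m+n (2 * (2 + m)) c)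

label-mono : ∀ m {x y} → x < y → label m x < label m y
label-mono m {zero}  {suc y} _   = four≤label m y
label-mono m {suc x} {suc y} x<y = +-monoʳ-< (2 * (2 + m)) (s≤s⁻¹ x<y)

label-≤ : ∀ m {x y} → x ≤ y → label m x ≤ label m y
label-≤ m x≤y with m≤n⇒m<n∨m≡n x≤y
... | inj₁ x<y  = <⇒≤ (label-mono m x<y)
... | inj₂ refl = ≤-refl

label-reflects : ∀ m {x y} → label m x < label m y → x < y
label-reflects m {x} {y} lx<ly with x <? y
... | yes x<y = x<y
... | no  x≮y = ⊥-elim (<⇒≱ lx<ly (label-≤ m (≮⇒≥ x≮y)))

-- Entries ≥ bound m never interact with the letters of level m-1 again;
-- at the last level the concrete values are compared with bound 0 = 10.
bound : ℕ → ℕ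
bound m = label m 7

below-bound : ∀ m {c} → c < 9 → label m c < bound (suc m)
below-bound m {c} c<9 = subst (label m c <_) (label-shift m 7) (label-mono m c<9)

above-bound : ∀ m {c} → 7 ≤ c → bound m ≤ label m c
above-bound m 7≤c = label-≤ m 7≤c

bound-mono : ∀ m → bound m ≤ bound (suc m)
bound-mono m = subst (bound m ≤_) (label-shift m 7) (label-≤ m (s≤s (s≤s (s≤s (s≤s (s≤s (s≤s (s≤s z≤n))))))))

-- When a level is left, the part of I from the first letter ≥ 7 on is parked:
-- it lies above everything that is still to come.
activePart parkedPart : List ℕ → List ℕ
activePart = takeWhile (_<? 7)
parkedPart = dropWhile (_<? 7)

split-I : ∀ (f : ℕ → ℕ) L B → map f L ++ B ≡ map f (activePart L) ++ map f (parkedPart L) ++ B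
split-I f L B = begin
  map f L ++ B                                          ≡⟨ cong (λ L′ → map f L′ ++ B) (sym (takeWhile++dropWhile (_<? 7) L)) ⟩
  map f (activePart L ++ parkedPart L) ++ B             ≡⟨ cong (_++ B) (map-++ f (activePart L) (parkedPart L)) ⟩
  (map f (activePart L) ++ map f (parkedPart L)) ++ B   ≡⟨ ++-assoc (map f (activePart L)) _ B ⟩
  map f (activePart L) ++ map f (parkedPart L) ++ B     ∎
  where open ≡-Reasoning

relabel-down : ∀ m xs → map (label m) (map shiftLetter xs) ≡ map (label (suc m)) xs
relabel-down m xs = trans (sym (map-∘ xs)) (map-cong (label-shift m) xs)

lower : List ℕ → AState → AState
lower p (as _ d1 d2 L _) = as p (map shiftLetter d1) (map shiftLetter d2) (map shiftLetter (activePart L)) []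

descend : ∀ m p R B d1 d2 L →
  conc (label (suc m)) (map (label m) p ++ R) B (as [] d1 d2 L [])
    ≡ conc (label m) R (map (label (suc m)) (parkedPart L) ++ B) (lower p (as [] d1 d2 L []))
descend m p R B d1 d2 L = st-cong refl (sym (relabel-down m d1)) (sym (relabel-down m d2))
  (trans (split-I (label (suc m)) L B) (cong (_++ (map (label (suc m)) (parkedPart L) ++ B)) (sym (relabel-down m (activePart L))))) refl

park : ∀ m L {B} → All (7 ≤_) (parkedPart L) → All (bound (suc m) ≤_) B →
       All (bound m ≤_) (map (label m) (parkedPart L) ++ B)
park m L parkable old = ++⁺ (map⁺ (All.map (above-bound m) parkable)) (All.map (≤-trans (bound-mono m)) old)

-- Below level 0 the values themselves serve as letters; e is the unread input.
toEnd : List ℕ → AState → AState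
toEnd e (as _ d1 d2 L _) = as e (map (label 0) d1) (map (label 0) d2) (map (label 0) (activePart L)) []

enter-end : ∀ e B d1 d2 L →
  conc (label 0) e B (as [] d1 d2 L []) ≡ conc id [] (map (label 0) (parkedPart L) ++ B) (toEnd e (as [] d1 d2 L []))
enter-end e B d1 d2 L = st-cong (sym (trans (++-identityʳ (map id e)) (map-id e)))
  (sym (map-id (map (label 0) d1))) (sym (map-id (map (label 0) d2)))
  (trans (split-I (label 0) L B) (cong (_++ (map (label 0) (parkedPart L) ++ B)) (sym (map-id (map (label 0) (activePart L)))))) refl

-- The input still unread once α(m+1) has been read up to its level-m window.
tailInput : ℕ → List ℕ
tailInput m = ω m ++ 1 ∷ 5 ∷ 2 ∷ []

tail-suc : ∀ m → tailInput (suc m) ≡ map (label m) (1 ∷ 4 ∷ []) ++ tailInput m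
tail-suc m = cong (λ x → x ∷ label m 4 ∷ tailInput m) (sym (+-identityʳ (2 * (2 + m))))

alpha-suc : ∀ m → α (suc m) ≡ map (label m) (3 ∷ 0 ∷ 1 ∷ 4 ∷ []) ++ tailInput m
alpha-suc m = cong₂ _∷_ first (cong (3 ∷_) (tail-suc m))
  where
  first : 2 * suc m + 4 ≡ label m 3
  first = begin
    2 * suc m + 4      ≡⟨ +-suc (2 * suc m) 3 ⟩
    suc (2 * suc m + 3) ≡⟨ cong suc (+-suc (2 * suc m) 2) ⟩
    2 + 2 * suc m + 2  ≡⟨ cong (_+ 2) (sym (*-suc 2 (suc m))) ⟩
    2 * (2 + m) + 2    ∎
    where open ≡-Reasoning

-- Non-sortability is shown by over-approximating all legal runs on α(j).
-- Outputs only grow, so a misplaced entry stays misplaced.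
Misplaced : List ℕ → Set
Misplaced o = Σ (List ℕ) λ pre → Σ ℕ λ x → Σ (List ℕ) λ post → (o ≡ pre ++ x ∷ post) × x ≢ suc (length pre)

misplaced-step : ∀ {s t} → Step s t → Misplaced (output s) → Misplaced (output t)
misplaced-step (d₀ _) m = m
misplaced-step (d₁ _) m = m
misplaced-step (d₂ _) m = m
misplaced-step (d₃ {x} _) (pre , y , post , o≡ , wrong) =
  pre , y , post ++ [ x ] , trans (cong (_++ [ x ]) o≡) (++-assoc pre (y ∷ post) [ x ]) , wrong

applyUpTo-entry : ∀ (f : ℕ → ℕ) n pre x post → applyUpTo f n ≡ pre ++ x ∷ post → x ≡ f (length pre)
applyUpTo-entry f (suc n) []        x post refl = refl
applyUpTo-entry f (suc n) (_ ∷ pre) x post eq   = applyUpTo-entry (f ∘ suc) n pre x post (∷-injectiveʳ eq)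

idPerm-in-place : ∀ n → ¬ Misplaced (idPerm n)
idPerm-in-place n (pre , x , post , eq , wrong) = wrong (applyUpTo-entry suc n pre x post (trans (sym (map-upTo suc n)) eq))

pushDecᵇ : ℕ → List ℕ → Bool
pushDecᵇ x []      = true
pushDecᵇ x (y ∷ _) = y <ᵇ x

pushIncᵇ : ℕ → List ℕ → Bool
pushIncᵇ x []      = true
pushIncᵇ x (y ∷ _) = x <ᵇ y

when : Bool → AState → List AState
when b a = if b then a ∷ [] else []

when-∈ : ∀ {b a} → T b → a ∈ when b a
when-∈ {true} _ = here refl

move₀ move₁ move₂ : AState → List AState
move₀ (as []      d1 d2 L o) = []
move₀ (as (x ∷ i) d1 d2 L o) = when (pushDecᵇ x d1) (as i (x ∷ d1) d2 L o)
move₁ (as i []       d2 L o) = []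
move₁ (as i (x ∷ d1) d2 L o) = when (pushDecᵇ x d2) (as i d1 (x ∷ d2) L o)
move₂ (as i d1 []       L o) = []
move₂ (as i d1 (x ∷ d2) L o) = when (pushIncᵇ x L) (as i d1 d2 (x ∷ L) o)

-- mayOutput x k: could the letter x be correct as output entry number k+1?
move₃ : (ℕ → ℕ → Bool) → AState → List AState
move₃ mayOutput (as i d1 d2 []      o) = []
move₃ mayOutput (as i d1 d2 (x ∷ L) o) = when (mayOutput x (length o)) (as i d1 d2 L (o ++ [ x ]))

successors : (ℕ → ℕ → Bool) → AState → List AState
successors mayOutput a = move₀ a ++ move₁ a ++ move₂ a ++ move₃ mayOutput a

-- Popping a parked entry (≥ β) is always wrong, and
-- the concrete input is only touched once the abstract input is used up.
module Simulation (v : ℕ → ℕ) (mayOutput : ℕ → ℕ → Bool)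
  (reflects : ∀ {x y} → v x < v y → T (x <ᵇ y))
  (correct⇒may : ∀ {x k} → v x ≡ suc k → T (mayOutput x k)) where

  Follows : List ℕ → List ℕ → AState → State → Set
  Follows rest B a t = Misplaced (output t) ⊎ Σ AState λ a′ → a′ ∈ successors mayOutput a × t ≡ conc v rest B a′

  dec-test : ∀ x d → CanPushDec (v x) (map v d) → T (pushDecᵇ x d)
  dec-test x []      _   = tt
  dec-test x (y ∷ d) y<x = reflects y<x

  inc-test : ∀ x L {B} → CanPushInc (v x) (map v L ++ B) → T (pushIncᵇ x L)
  inc-test x []      _   = tt
  inc-test x (y ∷ L) x<y = reflects x<y

  simulate′ : ∀ {β} rest B a {s t} → All (β ≤_) B → suc (length (aout a)) < β →
              (ain a ≡ [] → rest ≡ []) → Step s t → s ≡ conc v rest B a → Follows rest B a t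
  simulate′ [] B (as [] d1 d2 L o) _ _ _ (d₀ _) ()
  simulate′ (_ ∷ _) B (as [] d1 d2 L o) _ _ no-input (d₀ _) _ with no-input refl
  ... | ()
  simulate′ rest B (as (x ∷ i) d1 d2 L o) _ _ _ (d₀ ok) refl =
    inj₂ (_ , ∈-++⁺ˡ (when-∈ (dec-test x d1 ok)) , refl)
  simulate′ rest B (as i [] d2 L o) _ _ _ (d₁ _) ()
  simulate′ rest B (as i (x ∷ d1) d2 L o) _ _ _ (d₁ ok) refl =
    inj₂ (_ , ∈-++⁺ʳ (move₀ a) (∈-++⁺ˡ (when-∈ (dec-test x d2 ok))) , refl)
    where a = as i (x ∷ d1) d2 L o
  simulate′ rest B (as i d1 [] L o) _ _ _ (d₂ _) ()
  simulate′ rest B (as i d1 (x ∷ d2) L o) _ _ _ (d₂ ok) refl =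
    inj₂ (_ , ∈-++⁺ʳ (move₀ a) (∈-++⁺ʳ (move₁ a) (∈-++⁺ˡ (when-∈ (inc-test x L ok)))) , refl)
    where a = as i d1 (x ∷ d2) L o
  simulate′ rest [] (as i d1 d2 [] o) _ _ _ (d₃ _) ()
  simulate′ {β} rest (b ∷ B) (as i d1 d2 [] o) (β≤b ∷ _) |o|<β _ (d₃ _) refl =
    inj₁ (map v o , b , [] , refl , λ b≡ → <-irrefl (sym b≡) (<-≤-trans position<β β≤b))
    where
    position<β : suc (length (map v o)) < β
    position<β = subst (λ n → suc n < β) (sym (length-map v o)) |o|<β
  simulate′ rest B (as i d1 d2 (x ∷ L) o) _ _ _ (d₃ _) refl with mayOutput x (length o) in may
  ... | true  = inj₂ (as i d1 d2 L (o ++ [ x ]) ,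
                      ∈-++⁺ʳ (move₀ a) (∈-++⁺ʳ (move₁ a) (∈-++⁺ʳ (move₂ a) (here refl))) ,
                      cong (st (map v i ++ rest) (map v d1) (map v d2) (map v L ++ B)) (sym (map-++ v o [ x ])))
    where a = as i d1 d2 (x ∷ L) o
  ... | false = inj₁ (map v o , v x , [] , refl , λ correct →
                      subst T may (correct⇒may (trans correct (cong suc (length-map v o)))))

  simulate : ∀ {β rest B a t} → All (β ≤_) B → suc (length (aout a)) < β → (ain a ≡ [] → rest ≡ []) →
             Step (conc v rest B a) t → Follows rest B a t
  simulate {rest = rest} {B} {a} parked short no-input step = simulate′ rest B a parked short no-input step refl

-- Certificate: the abstract states reachable while the window is inside ω
-- (letters labelled by `label m`, unread input tailInput m) ...
midStates : List AState
midStates =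
  as (0 ∷ 1 ∷ 4 ∷ []) [] [] (3 ∷ []) []
  ∷ as (0 ∷ 1 ∷ 4 ∷ []) [] (3 ∷ []) [] []
  ∷ as (0 ∷ 1 ∷ 4 ∷ []) (3 ∷ []) [] [] []
  ∷ as (1 ∷ 4 ∷ []) [] [] (0 ∷ 3 ∷ []) []
  ∷ as (1 ∷ 4 ∷ []) [] [] (0 ∷ 3 ∷ 5 ∷ 6 ∷ []) []
  ∷ as (1 ∷ 4 ∷ []) [] [] (0 ∷ 3 ∷ 5 ∷ 6 ∷ 7 ∷ 8 ∷ []) []
  ∷ as (1 ∷ 4 ∷ []) [] (0 ∷ []) (3 ∷ []) []
  ∷ as (1 ∷ 4 ∷ []) [] (0 ∷ []) (3 ∷ 5 ∷ 6 ∷ []) []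
  ∷ as (1 ∷ 4 ∷ []) [] (0 ∷ []) (3 ∷ 5 ∷ 6 ∷ 7 ∷ 8 ∷ []) []
  ∷ as (1 ∷ 4 ∷ []) [] (6 ∷ []) (0 ∷ 3 ∷ 5 ∷ []) []
  ∷ as (1 ∷ 4 ∷ []) [] (6 ∷ []) (0 ∷ 3 ∷ 5 ∷ 7 ∷ 8 ∷ []) []
  ∷ as (1 ∷ 4 ∷ []) [] (6 ∷ 0 ∷ []) (3 ∷ 5 ∷ []) []
  ∷ as (1 ∷ 4 ∷ []) [] (6 ∷ 0 ∷ []) (3 ∷ 5 ∷ 7 ∷ 8 ∷ []) []
  ∷ as (1 ∷ 4 ∷ []) [] (6 ∷ 3 ∷ []) (0 ∷ 5 ∷ []) []
  ∷ as (1 ∷ 4 ∷ []) [] (6 ∷ 3 ∷ []) (0 ∷ 5 ∷ 7 ∷ 8 ∷ []) []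
  ∷ as (1 ∷ 4 ∷ []) [] (6 ∷ 3 ∷ 0 ∷ []) (5 ∷ []) []
  ∷ as (1 ∷ 4 ∷ []) [] (6 ∷ 3 ∷ 0 ∷ []) (5 ∷ 7 ∷ 8 ∷ []) []
  ∷ as (1 ∷ 4 ∷ []) (0 ∷ []) [] (3 ∷ []) []
  ∷ as (1 ∷ 4 ∷ []) (0 ∷ []) [] (3 ∷ 5 ∷ 6 ∷ []) []
  ∷ as (1 ∷ 4 ∷ []) (0 ∷ []) [] (3 ∷ 5 ∷ 6 ∷ 7 ∷ 8 ∷ []) []
  ∷ as (1 ∷ 4 ∷ []) (0 ∷ []) (3 ∷ []) [] []
  ∷ as (1 ∷ 4 ∷ []) (0 ∷ []) (3 ∷ []) (5 ∷ 6 ∷ []) []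
  ∷ as (1 ∷ 4 ∷ []) (0 ∷ []) (3 ∷ []) (5 ∷ 6 ∷ 7 ∷ 8 ∷ []) []
  ∷ as (1 ∷ 4 ∷ []) (0 ∷ []) (6 ∷ []) (3 ∷ 5 ∷ []) []
  ∷ as (1 ∷ 4 ∷ []) (0 ∷ []) (6 ∷ []) (3 ∷ 5 ∷ 7 ∷ 8 ∷ []) []
  ∷ as (1 ∷ 4 ∷ []) (0 ∷ []) (6 ∷ 3 ∷ []) (5 ∷ []) []
  ∷ as (1 ∷ 4 ∷ []) (0 ∷ []) (6 ∷ 3 ∷ []) (5 ∷ 7 ∷ 8 ∷ []) []
  ∷ as (1 ∷ 4 ∷ []) (3 ∷ []) (6 ∷ []) (0 ∷ 5 ∷ []) []
  ∷ as (1 ∷ 4 ∷ []) (3 ∷ []) (6 ∷ []) (0 ∷ 5 ∷ 7 ∷ 8 ∷ []) []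
  ∷ as (1 ∷ 4 ∷ []) (3 ∷ []) (6 ∷ 0 ∷ []) (5 ∷ []) []
  ∷ as (1 ∷ 4 ∷ []) (3 ∷ []) (6 ∷ 0 ∷ []) (5 ∷ 7 ∷ 8 ∷ []) []
  ∷ as (1 ∷ 4 ∷ []) (3 ∷ 0 ∷ []) [] (5 ∷ 6 ∷ []) []
  ∷ as (1 ∷ 4 ∷ []) (3 ∷ 0 ∷ []) [] (5 ∷ 6 ∷ 7 ∷ 8 ∷ []) []
  ∷ as (1 ∷ 4 ∷ []) (3 ∷ 0 ∷ []) (5 ∷ []) (6 ∷ []) []
  ∷ as (1 ∷ 4 ∷ []) (3 ∷ 0 ∷ []) (5 ∷ []) (6 ∷ 7 ∷ 8 ∷ []) []
  ∷ as (1 ∷ 4 ∷ []) (3 ∷ 0 ∷ []) (6 ∷ []) (5 ∷ []) []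
  ∷ as (1 ∷ 4 ∷ []) (3 ∷ 0 ∷ []) (6 ∷ []) (5 ∷ 7 ∷ 8 ∷ []) []
  ∷ as (1 ∷ 4 ∷ []) (3 ∷ 0 ∷ []) (6 ∷ 5 ∷ []) [] []
  ∷ as (1 ∷ 4 ∷ []) (3 ∷ 0 ∷ []) (6 ∷ 5 ∷ []) (7 ∷ 8 ∷ []) []
  ∷ as (1 ∷ 4 ∷ []) (6 ∷ []) [] (0 ∷ 3 ∷ 5 ∷ []) []
  ∷ as (1 ∷ 4 ∷ []) (6 ∷ []) [] (0 ∷ 3 ∷ 5 ∷ 7 ∷ 8 ∷ []) []
  ∷ as (1 ∷ 4 ∷ []) (6 ∷ []) (0 ∷ []) (3 ∷ 5 ∷ []) []
  ∷ as (1 ∷ 4 ∷ []) (6 ∷ []) (0 ∷ []) (3 ∷ 5 ∷ 7 ∷ 8 ∷ []) []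
  ∷ as (1 ∷ 4 ∷ []) (6 ∷ []) (3 ∷ []) (0 ∷ 5 ∷ []) []
  ∷ as (1 ∷ 4 ∷ []) (6 ∷ []) (3 ∷ []) (0 ∷ 5 ∷ 7 ∷ 8 ∷ []) []
  ∷ as (1 ∷ 4 ∷ []) (6 ∷ []) (3 ∷ 0 ∷ []) (5 ∷ []) []
  ∷ as (1 ∷ 4 ∷ []) (6 ∷ []) (3 ∷ 0 ∷ []) (5 ∷ 7 ∷ 8 ∷ []) []
  ∷ as (1 ∷ 4 ∷ []) (6 ∷ 0 ∷ []) [] (3 ∷ 5 ∷ []) []
  ∷ as (1 ∷ 4 ∷ []) (6 ∷ 0 ∷ []) [] (3 ∷ 5 ∷ 7 ∷ 8 ∷ []) []
  ∷ as (1 ∷ 4 ∷ []) (6 ∷ 0 ∷ []) (3 ∷ []) (5 ∷ []) []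
  ∷ as (1 ∷ 4 ∷ []) (6 ∷ 0 ∷ []) (3 ∷ []) (5 ∷ 7 ∷ 8 ∷ []) []
  ∷ as (1 ∷ 4 ∷ []) (6 ∷ 3 ∷ []) [] (0 ∷ 5 ∷ []) []
  ∷ as (1 ∷ 4 ∷ []) (6 ∷ 3 ∷ []) [] (0 ∷ 5 ∷ 7 ∷ 8 ∷ []) []
  ∷ as (1 ∷ 4 ∷ []) (6 ∷ 3 ∷ []) (0 ∷ []) (5 ∷ []) []
  ∷ as (1 ∷ 4 ∷ []) (6 ∷ 3 ∷ []) (0 ∷ []) (5 ∷ 7 ∷ 8 ∷ []) []
  ∷ as (1 ∷ 4 ∷ []) (6 ∷ 3 ∷ []) (8 ∷ []) (0 ∷ 5 ∷ 7 ∷ []) []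
  ∷ as (1 ∷ 4 ∷ []) (6 ∷ 3 ∷ []) (8 ∷ 0 ∷ []) (5 ∷ 7 ∷ []) []
  ∷ as (1 ∷ 4 ∷ []) (6 ∷ 3 ∷ []) (8 ∷ 5 ∷ []) (0 ∷ 7 ∷ []) []
  ∷ as (1 ∷ 4 ∷ []) (6 ∷ 3 ∷ []) (8 ∷ 5 ∷ 0 ∷ []) (7 ∷ []) []
  ∷ as (1 ∷ 4 ∷ []) (6 ∷ 3 ∷ 0 ∷ []) [] (5 ∷ []) []
  ∷ as (1 ∷ 4 ∷ []) (6 ∷ 3 ∷ 0 ∷ []) [] (5 ∷ 7 ∷ 8 ∷ []) []
  ∷ as (1 ∷ 4 ∷ []) (6 ∷ 3 ∷ 0 ∷ []) (5 ∷ []) [] []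
  ∷ as (1 ∷ 4 ∷ []) (6 ∷ 3 ∷ 0 ∷ []) (5 ∷ []) (7 ∷ 8 ∷ []) []
  ∷ as (1 ∷ 4 ∷ []) (6 ∷ 3 ∷ 0 ∷ []) (8 ∷ []) (5 ∷ 7 ∷ []) []
  ∷ as (1 ∷ 4 ∷ []) (6 ∷ 3 ∷ 0 ∷ []) (8 ∷ 5 ∷ []) (7 ∷ []) []
  ∷ as (3 ∷ 0 ∷ 1 ∷ 4 ∷ []) [] [] [] []
  ∷ as (4 ∷ []) [] [] (0 ∷ 1 ∷ 3 ∷ []) []
  ∷ as (4 ∷ []) [] [] (0 ∷ 1 ∷ 3 ∷ 5 ∷ 6 ∷ []) []
  ∷ as (4 ∷ []) [] [] (0 ∷ 1 ∷ 3 ∷ 5 ∷ 6 ∷ 7 ∷ 8 ∷ []) []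
  ∷ as (4 ∷ []) [] (0 ∷ []) (1 ∷ 3 ∷ []) []
  ∷ as (4 ∷ []) [] (0 ∷ []) (1 ∷ 3 ∷ 5 ∷ 6 ∷ []) []
  ∷ as (4 ∷ []) [] (0 ∷ []) (1 ∷ 3 ∷ 5 ∷ 6 ∷ 7 ∷ 8 ∷ []) []
  ∷ as (4 ∷ []) [] (1 ∷ []) (0 ∷ 3 ∷ []) []
  ∷ as (4 ∷ []) [] (1 ∷ []) (0 ∷ 3 ∷ 5 ∷ 6 ∷ []) []
  ∷ as (4 ∷ []) [] (1 ∷ []) (0 ∷ 3 ∷ 5 ∷ 6 ∷ 7 ∷ 8 ∷ []) []
  ∷ as (4 ∷ []) [] (1 ∷ 0 ∷ []) (3 ∷ []) []
  ∷ as (4 ∷ []) [] (1 ∷ 0 ∷ []) (3 ∷ 5 ∷ 6 ∷ []) []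
  ∷ as (4 ∷ []) [] (1 ∷ 0 ∷ []) (3 ∷ 5 ∷ 6 ∷ 7 ∷ 8 ∷ []) []
  ∷ as (4 ∷ []) (0 ∷ []) [] (1 ∷ 3 ∷ []) []
  ∷ as (4 ∷ []) (0 ∷ []) [] (1 ∷ 3 ∷ 5 ∷ 6 ∷ []) []
  ∷ as (4 ∷ []) (0 ∷ []) [] (1 ∷ 3 ∷ 5 ∷ 6 ∷ 7 ∷ 8 ∷ []) []
  ∷ as (4 ∷ []) (0 ∷ []) (1 ∷ []) (3 ∷ []) []
  ∷ as (4 ∷ []) (0 ∷ []) (1 ∷ []) (3 ∷ 5 ∷ 6 ∷ []) []
  ∷ as (4 ∷ []) (0 ∷ []) (1 ∷ []) (3 ∷ 5 ∷ 6 ∷ 7 ∷ 8 ∷ []) []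
  ∷ as (4 ∷ []) (1 ∷ []) [] (0 ∷ 3 ∷ []) []
  ∷ as (4 ∷ []) (1 ∷ []) [] (0 ∷ 3 ∷ 5 ∷ 6 ∷ []) []
  ∷ as (4 ∷ []) (1 ∷ []) [] (0 ∷ 3 ∷ 5 ∷ 6 ∷ 7 ∷ 8 ∷ []) []
  ∷ as (4 ∷ []) (1 ∷ []) (0 ∷ []) (3 ∷ []) []
  ∷ as (4 ∷ []) (1 ∷ []) (0 ∷ []) (3 ∷ 5 ∷ 6 ∷ []) []
  ∷ as (4 ∷ []) (1 ∷ []) (0 ∷ []) (3 ∷ 5 ∷ 6 ∷ 7 ∷ 8 ∷ []) []
  ∷ as (4 ∷ []) (1 ∷ []) (6 ∷ []) (0 ∷ 3 ∷ 5 ∷ []) []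
  ∷ as (4 ∷ []) (1 ∷ []) (6 ∷ []) (0 ∷ 3 ∷ 5 ∷ 7 ∷ 8 ∷ []) []
  ∷ as (4 ∷ []) (1 ∷ []) (6 ∷ 0 ∷ []) (3 ∷ 5 ∷ []) []
  ∷ as (4 ∷ []) (1 ∷ []) (6 ∷ 0 ∷ []) (3 ∷ 5 ∷ 7 ∷ 8 ∷ []) []
  ∷ as (4 ∷ []) (1 ∷ []) (6 ∷ 3 ∷ []) (0 ∷ 5 ∷ []) []
  ∷ as (4 ∷ []) (1 ∷ []) (6 ∷ 3 ∷ []) (0 ∷ 5 ∷ 7 ∷ 8 ∷ []) []
  ∷ as (4 ∷ []) (1 ∷ []) (6 ∷ 3 ∷ 0 ∷ []) (5 ∷ []) []
  ∷ as (4 ∷ []) (1 ∷ []) (6 ∷ 3 ∷ 0 ∷ []) (5 ∷ 7 ∷ 8 ∷ []) []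
  ∷ as (4 ∷ []) (1 ∷ 0 ∷ []) [] (3 ∷ []) []
  ∷ as (4 ∷ []) (1 ∷ 0 ∷ []) [] (3 ∷ 5 ∷ 6 ∷ []) []
  ∷ as (4 ∷ []) (1 ∷ 0 ∷ []) [] (3 ∷ 5 ∷ 6 ∷ 7 ∷ 8 ∷ []) []
  ∷ as (4 ∷ []) (1 ∷ 0 ∷ []) (3 ∷ []) [] []
  ∷ as (4 ∷ []) (1 ∷ 0 ∷ []) (3 ∷ []) (5 ∷ 6 ∷ []) []
  ∷ as (4 ∷ []) (1 ∷ 0 ∷ []) (3 ∷ []) (5 ∷ 6 ∷ 7 ∷ 8 ∷ []) []
  ∷ as (4 ∷ []) (1 ∷ 0 ∷ []) (6 ∷ []) (3 ∷ 5 ∷ []) []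
  ∷ as (4 ∷ []) (1 ∷ 0 ∷ []) (6 ∷ []) (3 ∷ 5 ∷ 7 ∷ 8 ∷ []) []
  ∷ as (4 ∷ []) (1 ∷ 0 ∷ []) (6 ∷ 3 ∷ []) (5 ∷ []) []
  ∷ as (4 ∷ []) (1 ∷ 0 ∷ []) (6 ∷ 3 ∷ []) (5 ∷ 7 ∷ 8 ∷ []) []
  ∷ []

-- ... and those reachable once only 1 5 2 is left (values used as letters).
endStates : List AState
endStates =
  as [] (2 ∷ []) (5 ∷ []) (1 ∷ 3 ∷ 4 ∷ []) []
  ∷ as [] (2 ∷ []) (5 ∷ []) (1 ∷ 3 ∷ 4 ∷ 6 ∷ 7 ∷ []) []
  ∷ as [] (2 ∷ []) (5 ∷ []) (1 ∷ 3 ∷ 4 ∷ 6 ∷ 7 ∷ 8 ∷ 9 ∷ []) []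
  ∷ as [] (2 ∷ []) (5 ∷ []) (3 ∷ 4 ∷ []) (1 ∷ [])
  ∷ as [] (2 ∷ []) (5 ∷ []) (3 ∷ 4 ∷ 6 ∷ 7 ∷ []) (1 ∷ [])
  ∷ as [] (2 ∷ []) (5 ∷ []) (3 ∷ 4 ∷ 6 ∷ 7 ∷ 8 ∷ 9 ∷ []) (1 ∷ [])
  ∷ as [] (2 ∷ []) (5 ∷ 1 ∷ []) (3 ∷ 4 ∷ []) []
  ∷ as [] (2 ∷ []) (5 ∷ 1 ∷ []) (3 ∷ 4 ∷ 6 ∷ 7 ∷ []) []
  ∷ as [] (2 ∷ []) (5 ∷ 1 ∷ []) (3 ∷ 4 ∷ 6 ∷ 7 ∷ 8 ∷ 9 ∷ []) []
  ∷ as [] (2 ∷ 1 ∷ []) (5 ∷ []) (3 ∷ 4 ∷ []) []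
  ∷ as [] (2 ∷ 1 ∷ []) (5 ∷ []) (3 ∷ 4 ∷ 6 ∷ 7 ∷ []) []
  ∷ as [] (2 ∷ 1 ∷ []) (5 ∷ []) (3 ∷ 4 ∷ 6 ∷ 7 ∷ 8 ∷ 9 ∷ []) []
  ∷ as [] (2 ∷ 1 ∷ []) (5 ∷ 3 ∷ []) (4 ∷ []) []
  ∷ as [] (2 ∷ 1 ∷ []) (5 ∷ 3 ∷ []) (4 ∷ 6 ∷ 7 ∷ []) []
  ∷ as [] (2 ∷ 1 ∷ []) (5 ∷ 3 ∷ []) (4 ∷ 6 ∷ 7 ∷ 8 ∷ 9 ∷ []) []
  ∷ as (1 ∷ 5 ∷ 2 ∷ []) [] [] (3 ∷ 4 ∷ []) []
  ∷ as (1 ∷ 5 ∷ 2 ∷ []) [] [] (3 ∷ 4 ∷ 6 ∷ 7 ∷ []) []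
  ∷ as (1 ∷ 5 ∷ 2 ∷ []) [] [] (3 ∷ 4 ∷ 6 ∷ 7 ∷ 8 ∷ 9 ∷ []) []
  ∷ as (1 ∷ 5 ∷ 2 ∷ []) [] (3 ∷ []) (4 ∷ []) []
  ∷ as (1 ∷ 5 ∷ 2 ∷ []) [] (3 ∷ []) (4 ∷ 6 ∷ 7 ∷ []) []
  ∷ as (1 ∷ 5 ∷ 2 ∷ []) [] (3 ∷ []) (4 ∷ 6 ∷ 7 ∷ 8 ∷ 9 ∷ []) []
  ∷ as (1 ∷ 5 ∷ 2 ∷ []) [] (7 ∷ []) (3 ∷ 4 ∷ 6 ∷ []) []
  ∷ as (1 ∷ 5 ∷ 2 ∷ []) [] (7 ∷ []) (3 ∷ 4 ∷ 6 ∷ 8 ∷ 9 ∷ []) []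
  ∷ as (1 ∷ 5 ∷ 2 ∷ []) [] (7 ∷ 3 ∷ []) (4 ∷ 6 ∷ []) []
  ∷ as (1 ∷ 5 ∷ 2 ∷ []) [] (7 ∷ 3 ∷ []) (4 ∷ 6 ∷ 8 ∷ 9 ∷ []) []
  ∷ as (1 ∷ 5 ∷ 2 ∷ []) [] (7 ∷ 4 ∷ []) (3 ∷ 6 ∷ []) []
  ∷ as (1 ∷ 5 ∷ 2 ∷ []) [] (7 ∷ 4 ∷ []) (3 ∷ 6 ∷ 8 ∷ 9 ∷ []) []
  ∷ as (1 ∷ 5 ∷ 2 ∷ []) [] (7 ∷ 4 ∷ 3 ∷ []) (6 ∷ []) []
  ∷ as (1 ∷ 5 ∷ 2 ∷ []) [] (7 ∷ 4 ∷ 3 ∷ []) (6 ∷ 8 ∷ 9 ∷ []) []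
  ∷ as (1 ∷ 5 ∷ 2 ∷ []) (3 ∷ []) [] (4 ∷ []) []
  ∷ as (1 ∷ 5 ∷ 2 ∷ []) (3 ∷ []) [] (4 ∷ 6 ∷ 7 ∷ []) []
  ∷ as (1 ∷ 5 ∷ 2 ∷ []) (3 ∷ []) [] (4 ∷ 6 ∷ 7 ∷ 8 ∷ 9 ∷ []) []
  ∷ as (1 ∷ 5 ∷ 2 ∷ []) (3 ∷ []) (4 ∷ []) [] []
  ∷ as (1 ∷ 5 ∷ 2 ∷ []) (3 ∷ []) (4 ∷ []) (6 ∷ 7 ∷ []) []
  ∷ as (1 ∷ 5 ∷ 2 ∷ []) (3 ∷ []) (4 ∷ []) (6 ∷ 7 ∷ 8 ∷ 9 ∷ []) []
  ∷ as (1 ∷ 5 ∷ 2 ∷ []) (3 ∷ []) (7 ∷ []) (4 ∷ 6 ∷ []) []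
  ∷ as (1 ∷ 5 ∷ 2 ∷ []) (3 ∷ []) (7 ∷ []) (4 ∷ 6 ∷ 8 ∷ 9 ∷ []) []
  ∷ as (1 ∷ 5 ∷ 2 ∷ []) (3 ∷ []) (7 ∷ 4 ∷ []) (6 ∷ []) []
  ∷ as (1 ∷ 5 ∷ 2 ∷ []) (3 ∷ []) (7 ∷ 4 ∷ []) (6 ∷ 8 ∷ 9 ∷ []) []
  ∷ as (1 ∷ 5 ∷ 2 ∷ []) (4 ∷ []) (7 ∷ []) (3 ∷ 6 ∷ []) []
  ∷ as (1 ∷ 5 ∷ 2 ∷ []) (4 ∷ []) (7 ∷ []) (3 ∷ 6 ∷ 8 ∷ 9 ∷ []) []
  ∷ as (1 ∷ 5 ∷ 2 ∷ []) (4 ∷ []) (7 ∷ 3 ∷ []) (6 ∷ []) []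
  ∷ as (1 ∷ 5 ∷ 2 ∷ []) (4 ∷ []) (7 ∷ 3 ∷ []) (6 ∷ 8 ∷ 9 ∷ []) []
  ∷ as (1 ∷ 5 ∷ 2 ∷ []) (4 ∷ 3 ∷ []) [] (6 ∷ 7 ∷ []) []
  ∷ as (1 ∷ 5 ∷ 2 ∷ []) (4 ∷ 3 ∷ []) [] (6 ∷ 7 ∷ 8 ∷ 9 ∷ []) []
  ∷ as (1 ∷ 5 ∷ 2 ∷ []) (4 ∷ 3 ∷ []) (6 ∷ []) (7 ∷ []) []
  ∷ as (1 ∷ 5 ∷ 2 ∷ []) (4 ∷ 3 ∷ []) (6 ∷ []) (7 ∷ 8 ∷ 9 ∷ []) []
  ∷ as (1 ∷ 5 ∷ 2 ∷ []) (4 ∷ 3 ∷ []) (7 ∷ []) (6 ∷ []) []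
  ∷ as (1 ∷ 5 ∷ 2 ∷ []) (4 ∷ 3 ∷ []) (7 ∷ []) (6 ∷ 8 ∷ 9 ∷ []) []
  ∷ as (1 ∷ 5 ∷ 2 ∷ []) (4 ∷ 3 ∷ []) (7 ∷ 6 ∷ []) [] []
  ∷ as (1 ∷ 5 ∷ 2 ∷ []) (4 ∷ 3 ∷ []) (7 ∷ 6 ∷ []) (8 ∷ 9 ∷ []) []
  ∷ as (1 ∷ 5 ∷ 2 ∷ []) (7 ∷ []) [] (3 ∷ 4 ∷ 6 ∷ []) []
  ∷ as (1 ∷ 5 ∷ 2 ∷ []) (7 ∷ []) [] (3 ∷ 4 ∷ 6 ∷ 8 ∷ 9 ∷ []) []
  ∷ as (1 ∷ 5 ∷ 2 ∷ []) (7 ∷ []) (3 ∷ []) (4 ∷ 6 ∷ []) []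
  ∷ as (1 ∷ 5 ∷ 2 ∷ []) (7 ∷ []) (3 ∷ []) (4 ∷ 6 ∷ 8 ∷ 9 ∷ []) []
  ∷ as (1 ∷ 5 ∷ 2 ∷ []) (7 ∷ []) (4 ∷ []) (3 ∷ 6 ∷ []) []
  ∷ as (1 ∷ 5 ∷ 2 ∷ []) (7 ∷ []) (4 ∷ []) (3 ∷ 6 ∷ 8 ∷ 9 ∷ []) []
  ∷ as (1 ∷ 5 ∷ 2 ∷ []) (7 ∷ []) (4 ∷ 3 ∷ []) (6 ∷ []) []
  ∷ as (1 ∷ 5 ∷ 2 ∷ []) (7 ∷ []) (4 ∷ 3 ∷ []) (6 ∷ 8 ∷ 9 ∷ []) []
  ∷ as (1 ∷ 5 ∷ 2 ∷ []) (7 ∷ 3 ∷ []) [] (4 ∷ 6 ∷ []) []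
  ∷ as (1 ∷ 5 ∷ 2 ∷ []) (7 ∷ 3 ∷ []) [] (4 ∷ 6 ∷ 8 ∷ 9 ∷ []) []
  ∷ as (1 ∷ 5 ∷ 2 ∷ []) (7 ∷ 3 ∷ []) (4 ∷ []) (6 ∷ []) []
  ∷ as (1 ∷ 5 ∷ 2 ∷ []) (7 ∷ 3 ∷ []) (4 ∷ []) (6 ∷ 8 ∷ 9 ∷ []) []
  ∷ as (1 ∷ 5 ∷ 2 ∷ []) (7 ∷ 4 ∷ []) [] (3 ∷ 6 ∷ []) []
  ∷ as (1 ∷ 5 ∷ 2 ∷ []) (7 ∷ 4 ∷ []) [] (3 ∷ 6 ∷ 8 ∷ 9 ∷ []) []
  ∷ as (1 ∷ 5 ∷ 2 ∷ []) (7 ∷ 4 ∷ []) (3 ∷ []) (6 ∷ []) []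
  ∷ as (1 ∷ 5 ∷ 2 ∷ []) (7 ∷ 4 ∷ []) (3 ∷ []) (6 ∷ 8 ∷ 9 ∷ []) []
  ∷ as (1 ∷ 5 ∷ 2 ∷ []) (7 ∷ 4 ∷ []) (9 ∷ []) (3 ∷ 6 ∷ 8 ∷ []) []
  ∷ as (1 ∷ 5 ∷ 2 ∷ []) (7 ∷ 4 ∷ []) (9 ∷ 3 ∷ []) (6 ∷ 8 ∷ []) []
  ∷ as (1 ∷ 5 ∷ 2 ∷ []) (7 ∷ 4 ∷ []) (9 ∷ 6 ∷ []) (3 ∷ 8 ∷ []) []
  ∷ as (1 ∷ 5 ∷ 2 ∷ []) (7 ∷ 4 ∷ []) (9 ∷ 6 ∷ 3 ∷ []) (8 ∷ []) []
  ∷ as (1 ∷ 5 ∷ 2 ∷ []) (7 ∷ 4 ∷ 3 ∷ []) [] (6 ∷ []) []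
  ∷ as (1 ∷ 5 ∷ 2 ∷ []) (7 ∷ 4 ∷ 3 ∷ []) [] (6 ∷ 8 ∷ 9 ∷ []) []
  ∷ as (1 ∷ 5 ∷ 2 ∷ []) (7 ∷ 4 ∷ 3 ∷ []) (6 ∷ []) [] []
  ∷ as (1 ∷ 5 ∷ 2 ∷ []) (7 ∷ 4 ∷ 3 ∷ []) (6 ∷ []) (8 ∷ 9 ∷ []) []
  ∷ as (1 ∷ 5 ∷ 2 ∷ []) (7 ∷ 4 ∷ 3 ∷ []) (9 ∷ []) (6 ∷ 8 ∷ []) []
  ∷ as (1 ∷ 5 ∷ 2 ∷ []) (7 ∷ 4 ∷ 3 ∷ []) (9 ∷ 6 ∷ []) (8 ∷ []) []
  ∷ as (2 ∷ []) [] (5 ∷ []) (1 ∷ 3 ∷ 4 ∷ []) []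
  ∷ as (2 ∷ []) [] (5 ∷ []) (1 ∷ 3 ∷ 4 ∷ 6 ∷ 7 ∷ []) []
  ∷ as (2 ∷ []) [] (5 ∷ []) (1 ∷ 3 ∷ 4 ∷ 6 ∷ 7 ∷ 8 ∷ 9 ∷ []) []
  ∷ as (2 ∷ []) [] (5 ∷ []) (3 ∷ 4 ∷ []) (1 ∷ [])
  ∷ as (2 ∷ []) [] (5 ∷ []) (3 ∷ 4 ∷ 6 ∷ 7 ∷ []) (1 ∷ [])
  ∷ as (2 ∷ []) [] (5 ∷ []) (3 ∷ 4 ∷ 6 ∷ 7 ∷ 8 ∷ 9 ∷ []) (1 ∷ [])
  ∷ as (2 ∷ []) [] (5 ∷ 1 ∷ []) (3 ∷ 4 ∷ []) []
  ∷ as (2 ∷ []) [] (5 ∷ 1 ∷ []) (3 ∷ 4 ∷ 6 ∷ 7 ∷ []) []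
  ∷ as (2 ∷ []) [] (5 ∷ 1 ∷ []) (3 ∷ 4 ∷ 6 ∷ 7 ∷ 8 ∷ 9 ∷ []) []
  ∷ as (2 ∷ []) (1 ∷ []) (5 ∷ []) (3 ∷ 4 ∷ []) []
  ∷ as (2 ∷ []) (1 ∷ []) (5 ∷ []) (3 ∷ 4 ∷ 6 ∷ 7 ∷ []) []
  ∷ as (2 ∷ []) (1 ∷ []) (5 ∷ []) (3 ∷ 4 ∷ 6 ∷ 7 ∷ 8 ∷ 9 ∷ []) []
  ∷ as (2 ∷ []) (1 ∷ []) (5 ∷ 3 ∷ []) (4 ∷ []) []
  ∷ as (2 ∷ []) (1 ∷ []) (5 ∷ 3 ∷ []) (4 ∷ 6 ∷ 7 ∷ []) []
  ∷ as (2 ∷ []) (1 ∷ []) (5 ∷ 3 ∷ []) (4 ∷ 6 ∷ 7 ∷ 8 ∷ 9 ∷ []) []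
  ∷ as (2 ∷ []) (5 ∷ []) [] (1 ∷ 3 ∷ 4 ∷ []) []
  ∷ as (2 ∷ []) (5 ∷ []) [] (1 ∷ 3 ∷ 4 ∷ 6 ∷ 7 ∷ []) []
  ∷ as (2 ∷ []) (5 ∷ []) [] (1 ∷ 3 ∷ 4 ∷ 6 ∷ 7 ∷ 8 ∷ 9 ∷ []) []
  ∷ as (2 ∷ []) (5 ∷ []) [] (3 ∷ 4 ∷ []) (1 ∷ [])
  ∷ as (2 ∷ []) (5 ∷ []) [] (3 ∷ 4 ∷ 6 ∷ 7 ∷ []) (1 ∷ [])
  ∷ as (2 ∷ []) (5 ∷ []) [] (3 ∷ 4 ∷ 6 ∷ 7 ∷ 8 ∷ 9 ∷ []) (1 ∷ [])
  ∷ as (2 ∷ []) (5 ∷ []) (1 ∷ []) (3 ∷ 4 ∷ []) []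
  ∷ as (2 ∷ []) (5 ∷ []) (1 ∷ []) (3 ∷ 4 ∷ 6 ∷ 7 ∷ []) []
  ∷ as (2 ∷ []) (5 ∷ []) (1 ∷ []) (3 ∷ 4 ∷ 6 ∷ 7 ∷ 8 ∷ 9 ∷ []) []
  ∷ as (2 ∷ []) (5 ∷ 1 ∷ []) [] (3 ∷ 4 ∷ []) []
  ∷ as (2 ∷ []) (5 ∷ 1 ∷ []) [] (3 ∷ 4 ∷ 6 ∷ 7 ∷ []) []
  ∷ as (2 ∷ []) (5 ∷ 1 ∷ []) [] (3 ∷ 4 ∷ 6 ∷ 7 ∷ 8 ∷ 9 ∷ []) []
  ∷ as (2 ∷ []) (5 ∷ 1 ∷ []) (3 ∷ []) (4 ∷ []) []
  ∷ as (2 ∷ []) (5 ∷ 1 ∷ []) (3 ∷ []) (4 ∷ 6 ∷ 7 ∷ []) []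
  ∷ as (2 ∷ []) (5 ∷ 1 ∷ []) (3 ∷ []) (4 ∷ 6 ∷ 7 ∷ 8 ∷ 9 ∷ []) []
  ∷ as (2 ∷ []) (5 ∷ 1 ∷ []) (7 ∷ []) (3 ∷ 4 ∷ 6 ∷ []) []
  ∷ as (2 ∷ []) (5 ∷ 1 ∷ []) (7 ∷ []) (3 ∷ 4 ∷ 6 ∷ 8 ∷ 9 ∷ []) []
  ∷ as (2 ∷ []) (5 ∷ 1 ∷ []) (7 ∷ 3 ∷ []) (4 ∷ 6 ∷ []) []
  ∷ as (2 ∷ []) (5 ∷ 1 ∷ []) (7 ∷ 3 ∷ []) (4 ∷ 6 ∷ 8 ∷ 9 ∷ []) []
  ∷ as (2 ∷ []) (5 ∷ 1 ∷ []) (7 ∷ 4 ∷ []) (3 ∷ 6 ∷ []) []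
  ∷ as (2 ∷ []) (5 ∷ 1 ∷ []) (7 ∷ 4 ∷ []) (3 ∷ 6 ∷ 8 ∷ 9 ∷ []) []
  ∷ as (2 ∷ []) (5 ∷ 1 ∷ []) (7 ∷ 4 ∷ 3 ∷ []) (6 ∷ []) []
  ∷ as (2 ∷ []) (5 ∷ 1 ∷ []) (7 ∷ 4 ∷ 3 ∷ []) (6 ∷ 8 ∷ 9 ∷ []) []
  ∷ as (3 ∷ 1 ∷ 5 ∷ 2 ∷ []) [] [] (4 ∷ []) []
  ∷ as (3 ∷ 1 ∷ 5 ∷ 2 ∷ []) [] (4 ∷ []) [] []
  ∷ as (3 ∷ 1 ∷ 5 ∷ 2 ∷ []) (4 ∷ []) [] [] []
  ∷ as (4 ∷ 3 ∷ 1 ∷ 5 ∷ 2 ∷ []) [] [] [] []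
  ∷ as (5 ∷ 2 ∷ []) [] [] (1 ∷ 3 ∷ 4 ∷ []) []
  ∷ as (5 ∷ 2 ∷ []) [] [] (1 ∷ 3 ∷ 4 ∷ 6 ∷ 7 ∷ []) []
  ∷ as (5 ∷ 2 ∷ []) [] [] (1 ∷ 3 ∷ 4 ∷ 6 ∷ 7 ∷ 8 ∷ 9 ∷ []) []
  ∷ as (5 ∷ 2 ∷ []) [] [] (3 ∷ 4 ∷ []) (1 ∷ [])
  ∷ as (5 ∷ 2 ∷ []) [] [] (3 ∷ 4 ∷ 6 ∷ 7 ∷ []) (1 ∷ [])
  ∷ as (5 ∷ 2 ∷ []) [] [] (3 ∷ 4 ∷ 6 ∷ 7 ∷ 8 ∷ 9 ∷ []) (1 ∷ [])
  ∷ as (5 ∷ 2 ∷ []) [] (1 ∷ []) (3 ∷ 4 ∷ []) []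
  ∷ as (5 ∷ 2 ∷ []) [] (1 ∷ []) (3 ∷ 4 ∷ 6 ∷ 7 ∷ []) []
  ∷ as (5 ∷ 2 ∷ []) [] (1 ∷ []) (3 ∷ 4 ∷ 6 ∷ 7 ∷ 8 ∷ 9 ∷ []) []
  ∷ as (5 ∷ 2 ∷ []) (1 ∷ []) [] (3 ∷ 4 ∷ []) []
  ∷ as (5 ∷ 2 ∷ []) (1 ∷ []) [] (3 ∷ 4 ∷ 6 ∷ 7 ∷ []) []
  ∷ as (5 ∷ 2 ∷ []) (1 ∷ []) [] (3 ∷ 4 ∷ 6 ∷ 7 ∷ 8 ∷ 9 ∷ []) []
  ∷ as (5 ∷ 2 ∷ []) (1 ∷ []) (3 ∷ []) (4 ∷ []) []
  ∷ as (5 ∷ 2 ∷ []) (1 ∷ []) (3 ∷ []) (4 ∷ 6 ∷ 7 ∷ []) []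
  ∷ as (5 ∷ 2 ∷ []) (1 ∷ []) (3 ∷ []) (4 ∷ 6 ∷ 7 ∷ 8 ∷ 9 ∷ []) []
  ∷ as (5 ∷ 2 ∷ []) (1 ∷ []) (7 ∷ []) (3 ∷ 4 ∷ 6 ∷ []) []
  ∷ as (5 ∷ 2 ∷ []) (1 ∷ []) (7 ∷ []) (3 ∷ 4 ∷ 6 ∷ 8 ∷ 9 ∷ []) []
  ∷ as (5 ∷ 2 ∷ []) (1 ∷ []) (7 ∷ 3 ∷ []) (4 ∷ 6 ∷ []) []
  ∷ as (5 ∷ 2 ∷ []) (1 ∷ []) (7 ∷ 3 ∷ []) (4 ∷ 6 ∷ 8 ∷ 9 ∷ []) []
  ∷ as (5 ∷ 2 ∷ []) (1 ∷ []) (7 ∷ 4 ∷ []) (3 ∷ 6 ∷ []) []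
  ∷ as (5 ∷ 2 ∷ []) (1 ∷ []) (7 ∷ 4 ∷ []) (3 ∷ 6 ∷ 8 ∷ 9 ∷ []) []
  ∷ as (5 ∷ 2 ∷ []) (1 ∷ []) (7 ∷ 4 ∷ 3 ∷ []) (6 ∷ []) []
  ∷ as (5 ∷ 2 ∷ []) (1 ∷ []) (7 ∷ 4 ∷ 3 ∷ []) (6 ∷ 8 ∷ 9 ∷ []) []
  ∷ []

-- Window letters stand for values ≥ 3, so they are never correct as output
-- entries 1 and 2; at the end the letter x is correct as entry k+1 iff x = k+1.
mayOutputMid : ℕ → ℕ → Bool
mayOutputMid _ k = 2 ≤ᵇ k

mayOutputEnd : ℕ → ℕ → Bool
mayOutputEnd x k = x ≡ᵇ suc k

descentCovered : AState → Bool
descentCovered a = ⌊ all? (7 ≤?_) (parkedPart (aI a)) ⌋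
  ∧ (lower (1 ∷ 4 ∷ []) a ∈ᵇ midStates ∧ toEnd (1 ∷ 5 ∷ 2 ∷ []) a ∈ᵇ endStates)

midCovered : AState → Bool
midCovered a@(as (_ ∷ _) _ _ _ []) = a ∈ᵇ midStates
midCovered a@(as [] _ _ _ [])      = descentCovered a
midCovered _                       = false

midValid : AState → Bool
midValid a@(as (_ ∷ _) _ _ _ []) = all midCovered (successors mayOutputMid a)
midValid _                       = false

endValid : AState → Bool
endValid a = (length (aout a) ≤ᵇ 1) ∧ all (_∈ᵇ endStates) (successors mayOutputEnd a)

midStates-valid : T (all midValid midStates)
midStates-valid = tt

endStates-valid : T (all endValid endStates)
endStates-valid = tt

record MidStateFacts (a : AState) : Set where
  field
    has-input : ain a ≢ []
    no-output : aout a ≡ []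
    covered   : All (T ∘ midCovered) (successors mayOutputMid a)

mid-facts : ∀ a → T (midValid a) → MidStateFacts a
mid-facts a@(as (_ ∷ _) _ _ _ []) ok = record { has-input = λ () ; no-output = refl ; covered = all⁺ midCovered _ ok }

mid-valid : ∀ {a} → a ∈ midStates → MidStateFacts a
mid-valid {a} a∈ = mid-facts a (holds midValid midStates midStates-valid a∈)

end-valid : ∀ {a} → a ∈ endStates → length (aout a) ≤ 1 × All (_∈ endStates) (successors mayOutputEnd a)
end-valid {a} a∈ = ≤ᵇ⇒≤ _ 1 (proj₁ ok) , All.map (∈ᵇ-sound endStates) (all⁺ (_∈ᵇ endStates) _ (proj₂ ok))
  where ok = split (length (aout a) ≤ᵇ 1) _ (holds endValid endStates endStates-valid a∈)

record DescentCovered (a : AState) : Set where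
  field
    parks-high : All (7 ≤_) (parkedPart (aI a))
    lowered    : lower (1 ∷ 4 ∷ []) a ∈ midStates
    ended      : toEnd (1 ∷ 5 ∷ 2 ∷ []) a ∈ endStates

descent-covered : ∀ a → T (descentCovered a) → DescentCovered a
descent-covered a ok = record
  { parks-high = toWitness (proj₁ p) ; lowered = ∈ᵇ-sound midStates (proj₁ q) ; ended = ∈ᵇ-sound endStates (proj₂ q) }
  where
  p = split ⌊ all? (7 ≤?_) (parkedPart (aI a)) ⌋ _ ok
  q = split (lower (1 ∷ 4 ∷ []) a ∈ᵇ midStates) (toEnd (1 ∷ 5 ∷ 2 ∷ []) a ∈ᵇ endStates) (proj₂ p)

-- Configurations of legal runs on α(j), up to relabelling: at level m with
-- unread input tailInput m, or in the end phase, or already misplaced.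
MidConfig EndConfig Reachable : State → Set
MidConfig s = Σ ℕ λ m → Σ AState λ a → Σ (List ℕ) λ B →
  a ∈ midStates × All (bound (suc m) ≤_) B × s ≡ conc (label m) (tailInput m) B a
EndConfig s = Σ AState λ a → Σ (List ℕ) λ B →
  a ∈ endStates × All (bound 0 ≤_) B × s ≡ conc id [] B a
Reachable s = Misplaced (output s) ⊎ MidConfig s ⊎ EndConfig s

-- The simulation at level m (labels reflect the order of letters and are
-- at least 3) and in the end phase (values are their own letters).
module MidSim (m : ℕ) = Simulation (label m) mayOutputMid
  (λ {x} {y} lx<ly → <⇒<ᵇ (label-reflects m {x} {y} lx<ly))
  (λ {x} lx≡ → ≤⇒≤ᵇ (s≤s⁻¹ (subst (3 ≤_) lx≡ (label-≤ m {0} {x} z≤n))))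

module EndSim = Simulation id mayOutputEnd <⇒<ᵇ (λ {x} {k} → ≡⇒≡ᵇ x (suc k))

mid-successor : ∀ m B a′ → All (bound (suc m) ≤_) B → T (midCovered a′) →
                Reachable (conc (label m) (tailInput m) B a′)
mid-successor m B a′@(as (_ ∷ _) _ _ _ []) parked covered =
  inj₂ (inj₁ (m , a′ , B , ∈ᵇ-sound midStates covered , parked , refl))
mid-successor (suc m) B a′@(as [] d1 d2 L []) parked covered =
  inj₂ (inj₁ (m , lower (1 ∷ 4 ∷ []) a′ , _ , lowered , park (suc m) L parks-high parked ,
              trans (cong (λ r → conc (label (suc m)) r B a′) (tail-suc m)) (descend m (1 ∷ 4 ∷ []) (tailInput m) B d1 d2 L)))
  where open DescentCovered (descent-covered a′ covered)
mid-successor zero B a′@(as [] d1 d2 L []) parked covered =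
  inj₂ (inj₂ (toEnd (1 ∷ 5 ∷ 2 ∷ []) a′ , _ , ended , park 0 L parks-high parked , enter-end (1 ∷ 5 ∷ 2 ∷ []) B d1 d2 L))
  where open DescentCovered (descent-covered a′ covered)

mid-step : ∀ {s t} → Step s t → MidConfig s → Reachable t
mid-step {t = t} step (m , a , B , a∈ , parked , refl) =
  continue (MidSim.simulate m parked short (λ no-input → ⊥-elim (has-input no-input)) step)
  where
  open MidStateFacts (mid-valid a∈)
  short : suc (length (aout a)) < bound (suc m)
  short = subst (λ o → suc (length o) < bound (suc m)) (sym no-output) (≤-trans (s≤s (s≤s z≤n)) (four≤label (suc m) 6))
  continue : MidSim.Follows m (tailInput m) B a t → Reachable t
  continue (inj₁ wrong)             = inj₁ wrong
  continue (inj₂ (a′ , a′∈ , refl)) = mid-successor m B a′ parked (All.lookup covered a′∈)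

end-step : ∀ {s t} → Step s t → EndConfig s → Reachable t
end-step {t = t} step (a , B , a∈ , parked , refl) = continue (EndSim.simulate parked short (λ _ → refl) step)
  where
  short : suc (length (aout a)) < bound 0
  short = s≤s (s≤s (≤-trans (proj₁ (end-valid a∈)) (s≤s z≤n)))
  continue : EndSim.Follows [] B a t → Reachable t
  continue (inj₁ wrong)             = inj₁ wrong
  continue (inj₂ (a′ , a′∈ , refl)) = inj₂ (inj₂ (a′ , B , All.lookup (proj₂ (end-valid a∈)) a′∈ , parked , refl))

reachable-step : ∀ {s t} → Step s t → Reachable s → Reachable t
reachable-step step (inj₁ wrong)      = inj₁ (misplaced-step step wrong)
reachable-step step (inj₂ (inj₁ mid)) = mid-step step mid
reachable-step step (inj₂ (inj₂ end)) = end-step step end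

reachable-run : ∀ {s t} → Star Step s t → Reachable s → Reachable t
reachable-run ε            r = r
reachable-run (step ◅ run) r = reachable-run run (reachable-step step r)

reachable-initial : ∀ j → Reachable (initial (α j))
reachable-initial zero    = inj₂ (inj₂ (_ , [] , ∈ᵇ-sound endStates tt , [] , refl))
reachable-initial (suc m) =
  inj₂ (inj₁ (m , as (3 ∷ 0 ∷ 1 ∷ 4 ∷ []) [] [] [] [] , [] , ∈ᵇ-sound midStates tt , [] , cong initial (alpha-suc m)))

short-output : ∀ j (v : ℕ → ℕ) o → length o ≤ 1 → map v o ≢ idPerm (length (α j))
short-output j v []          _        ()
short-output j v (_ ∷ [])    _        ()
short-output j v (_ ∷ _ ∷ _) (s≤s ()) _

-- Every reachable configuration has a misplaced entry or at most one output
-- entry, so no legal run sorts α(j).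
unsortable : ∀ j → ¬ Sortable₂ (α j)
unsortable j (s , run , sorted) with reachable-run run (reachable-initial j)
... | inj₁ wrong = idPerm-in-place _ (subst Misplaced sorted wrong)
... | inj₂ (inj₁ (m , a , _ , a∈ , _ , refl)) =
  short-output j (label m) (aout a) (subst (λ o → length o ≤ 1) (sym (MidStateFacts.no-output (mid-valid a∈))) z≤n) sorted
... | inj₂ (inj₂ (a , _ , a∈ , _ , refl)) = short-output j id (aout a) (proj₁ (end-valid a∈)) sorted

-- Sortability of the one-point deletions is shown by explicit strict runs.
-- Strict abstract operations 0–3.  Letters pushed onto I (and output) must
-- be below `cap`, which keeps them below the parked entries; d₃ is allowed
-- only when `outputs` holds, i.e. once no concrete input is left.
strictMove : (cap : ℕ) → (outputs : Bool) → ℕ → AState → Maybe AState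
strictMove cap outputs 0 (as (x ∷ i) d1 d2 L o) =
  if all (_<ᵇ x) d1 then just (as i (x ∷ d1) d2 L o) else nothing
strictMove cap outputs 1 (as i (x ∷ d1) d2 L o) =
  if all (_<ᵇ x) d2 then just (as i d1 (x ∷ d2) L o) else nothing
strictMove cap outputs 2 (as i d1 (x ∷ d2) L o) =
  if all (x <ᵇ_) L ∧ (x <ᵇ cap) then just (as i d1 d2 (x ∷ L) o) else nothing
strictMove cap outputs 3 (as i d1 d2 (x ∷ L) o) =
  if outputs ∧ (all (x <ᵇ_) (i ++ d1 ++ d2 ++ L) ∧ (x <ᵇ cap)) then just (as i d1 d2 L (o ++ [ x ])) else nothing
strictMove _ _ _ _ = nothing

execute : (cap : ℕ) → (outputs : Bool) → List ℕ → AState → Maybe AState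
execute cap outputs []         a = just a
execute cap outputs (op ∷ ops) a with strictMove cap outputs op a
... | just a′ = execute cap outputs ops a′
... | nothing = nothing

-- Within a level no output is made and letters stay below 9; at the end the
-- values are letters and all of them are below 10.
runMid runEnd : List ℕ → AState → Maybe AState
runMid = execute 9 false
runEnd = execute 10 true

module Realise (v : ℕ → ℕ) (mono : ∀ {x y} → T (x <ᵇ y) → v x < v y)
  (cap β : ℕ) (capped : ∀ {x} → T (x <ᵇ cap) → v x < β) where

  below : ∀ x ys → T (all (_<ᵇ x) ys) → All (_< v x) (map v ys)
  below x ys ok = map⁺ (All.map mono (all⁺ (_<ᵇ x) ys ok))

  above : ∀ x ys → T (all (x <ᵇ_) ys) → All (v x <_) (map v ys)
  above x ys ok = map⁺ (All.map mono (all⁺ (x <ᵇ_) ys ok))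

  above-parked : ∀ {x} B → T (x <ᵇ cap) → All (β ≤_) B → All (v x <_) B
  above-parked B x<cap parked = All.map (<-≤-trans (capped x<cap)) parked

  move-sound : ∀ outputs op a a′ rest B → strictMove cap outputs op a ≡ just a′ →
               (T outputs → rest ≡ []) → All (β ≤_) B → StrictStep (conc v rest B a) (conc v rest B a′)
  move-sound outputs 0 (as (x ∷ i) d1 d2 L o) a′ rest B moved _ _ with all (_<ᵇ x) d1 in ok
  move-sound outputs 0 (as (x ∷ i) d1 d2 L o) a′ rest B refl _ _ | true = s₀ (below x d1 (T-true ok))
  move-sound outputs 1 (as i (x ∷ d1) d2 L o) a′ rest B moved _ _ with all (_<ᵇ x) d2 in ok
  move-sound outputs 1 (as i (x ∷ d1) d2 L o) a′ rest B refl _ _ | true = s₁ (below x d2 (T-true ok))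
  move-sound outputs 2 (as i d1 (x ∷ d2) L o) a′ rest B moved _ _ with all (x <ᵇ_) L in ok | x <ᵇ cap in x<cap
  move-sound outputs 2 (as i d1 (x ∷ d2) L o) a′ rest B refl _ parked | true | true =
    s₂ (++⁺ (above x L (T-true ok)) (above-parked B (T-true x<cap) parked))
  move-sound outputs 3 (as i d1 d2 (x ∷ L) o) a′ rest B moved _ _
    with outputs in out | all (x <ᵇ_) (i ++ d1 ++ d2 ++ L) in ok | x <ᵇ cap in x<cap
  move-sound outputs 3 (as i d1 d2 (x ∷ L) o) a′ rest B refl no-rest parked | true | true | true
    rewrite no-rest tt | map-++ v o [ x ] =
    s₃ (subst (All (v x <_)) (sym rearranged) (++⁺ (above x (i ++ d1 ++ d2 ++ L) (T-true ok))
                                                    (above-parked B (T-true x<cap) parked)))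
    where
    rearranged : (map v i ++ []) ++ map v d1 ++ map v d2 ++ map v L ++ B ≡ map v (i ++ d1 ++ d2 ++ L) ++ B
    rearranged rewrite ++-identityʳ (map v i) | map-++ v i (d1 ++ d2 ++ L) | map-++ v d1 (d2 ++ L) | map-++ v d2 L
                     | ++-assoc (map v i) (map v d1 ++ map v d2 ++ map v L) B | ++-assoc (map v d1) (map v d2 ++ map v L) B
                     | ++-assoc (map v d2) (map v L) B = refl

  execute-sound : ∀ outputs ops a a′ rest B → execute cap outputs ops a ≡ just a′ →
                  (T outputs → rest ≡ []) → All (β ≤_) B → Star StrictStep (conc v rest B a) (conc v rest B a′)
  execute-sound outputs []         a a′ rest B refl _ _ = ε
  execute-sound outputs (op ∷ ops) a a′ rest B ran no-rest parked with strictMove cap outputs op a in moved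
  ... | just a″ = move-sound outputs op a a″ rest B moved no-rest parked ◅ execute-sound outputs ops a″ a′ rest B ran no-rest parked

Parked : ℕ → List ℕ → Set
Parked β B = AllPairs _<_ B × All (β ≤_) B

Parkable : List ℕ → Set
Parkable P = All (λ c → 7 ≤ c × c < 9) P × AllPairs _<_ P

parkable? : Decidable Parkable
parkable? P = all? (λ c → 7 ≤? c ×-dec c <? 9) P ×-dec allPairs? _<?_ P

park-sorted : ∀ m L {B} → Parkable (parkedPart L) → Parked (bound (suc m)) B →
              Parked (bound m) (map (label m) (parkedPart L) ++ B)
park-sorted m L (range , increasing) (B-increasing , B-high) =
  AllPairsP.++⁺ (AllPairsP.map⁺ (AllPairs.map (label-mono m) increasing)) B-increasing
                (map⁺ (All.map (λ c-range → All.map (<-≤-trans (below-bound m (proj₂ c-range))) B-high) range)) ,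
  park m L (All.map proj₁ range) B-high

module MidRealise (m : ℕ) =
  Realise (label m) (λ {x} {y} x<y → label-mono m (<ᵇ⇒< x y x<y)) 9 (bound (suc m)) (λ {x} x<9 → below-bound m (<ᵇ⇒< x 9 x<9))
module EndRealise = Realise id (λ {x} {y} → <ᵇ⇒< x y) 10 10 (λ {x} → <ᵇ⇒< x 10)

advance : ∀ m R {B} ops a a′ → runMid ops a ≡ just a′ → All (bound (suc m) ≤_) B →
          Completes (conc (label m) R B a′) → Completes (conc (label m) R B a)
advance m R {B} ops a a′ ran parked (o , run) = o , (MidRealise.execute-sound m false ops a a′ R B ran (λ ()) parked ◅◅ run)

drain : ∀ B out → AllPairs _<_ B → Star StrictStep (st [] [] [] B out) (st [] [] [] [] (out ++ B))
drain []      out []              = subst (λ o → Star StrictStep (st [] [] [] [] out) (st [] [] [] [] o)) (sym (++-identityʳ out)) ε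
drain (b ∷ B) out (b<B ∷ B-incr) =
  s₃ b<B ◅ subst (λ o → Star StrictStep (st [] [] [] B (out ++ [ b ])) (st [] [] [] [] o))
                 (++-assoc out [ b ] B) (drain B (out ++ [ b ]) B-incr)

finish : ∀ ops a o {B} → runEnd ops a ≡ just (as [] [] [] [] o) → Parked (bound 0) B → Completes (conc id [] B a)
finish ops a o {B} ran (B-incr , B-high) =
  _ , (EndRealise.execute-sound true ops a _ [] B ran (λ _ → refl) B-high ◅◅ drain B (map id o) B-incr)

descend-completes : ∀ m p R d1 d2 L {B} ops a′ → Parkable (parkedPart L) →
  runMid ops (lower p (as [] d1 d2 L [])) ≡ just a′ →
  (∀ {B′} → Parked (bound (suc m)) B′ → Completes (conc (label m) R B′ a′)) →
  Parked (bound (suc (suc m))) B → Completes (conc (label (suc m)) (map (label m) p ++ R) B (as [] d1 d2 L []))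
descend-completes m p R d1 d2 L {B} ops a′ parkable ran completes parked =
  subst Completes (sym (descend m p R B d1 d2 L)) (advance m R ops _ a′ ran (proj₂ parked′) (completes parked′))
  where parked′ = park-sorted (suc m) L parkable parked

end-completes : ∀ e d1 d2 L {B} ops o → Parkable (parkedPart L) →
  runEnd ops (toEnd e (as [] d1 d2 L [])) ≡ just (as [] [] [] [] o) →
  Parked (bound 1) B → Completes (conc (label 0) e B (as [] d1 d2 L []))
end-completes e d1 d2 L {B} ops o parkable ran parked =
  subst Completes (sym (enter-end e B d1 d2 L)) (finish ops _ o ran (park-sorted 0 L parkable parked))

completesᵇ : Maybe AState → Bool
completesᵇ (just (as [] [] [] [] _)) = true
completesᵇ _                         = false

completesᵇ-sound : ∀ r → T (completesᵇ r) → Σ (List ℕ) λ o → r ≡ just (as [] [] [] [] o)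
completesᵇ-sound (just (as [] [] [] [] o)) _ = o , refl

landsIn : {A : Set} → (A → AState) → List A → Maybe AState → Bool
landsIn node Ps (just a) = any (sameState a ∘ node) Ps
landsIn node Ps nothing  = false

landsIn-sound : ∀ {A : Set} (node : A → AState) Ps r → T (landsIn node Ps r) → Σ A λ P → P ∈ Ps × r ≡ just (node P)
landsIn-sound node Ps (just a) lands with find (any⁻ (sameState a ∘ node) Ps lands)
... | P , P∈ , same = P , P∈ , cong just (sameState-sound a (node P) same)

-- A plan for the boundary configuration with stacks D₁, D₂, I (no input,
-- no output): a run finishing it at level 0, where 1 5 2 is left to read,
-- and a run consuming the next window 1 4 one level further down.
record Plan : Set where
  constructor plan
  field
    stack₁ stack₂ stackI finishRun advanceRun : List ℕ

planNode : Plan → AState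
planNode P = as [] stack₁ stack₂ stackI [] where open Plan P

-- Plans for the boundary configurations reached after reading a window of
-- α(m+1) in full; the table is closed under advancing one level.
mainPlans : List Plan
mainPlans =
    plan (4 ∷ 1 ∷ []) (0 ∷ []) []
         (1 ∷ 2 ∷ 1 ∷ 0 ∷ 0 ∷ 1 ∷ 0 ∷ 2 ∷ 2 ∷ 2 ∷ 1 ∷ 2 ∷ 1 ∷ 2 ∷ 3 ∷ 3 ∷ 3 ∷ 3 ∷ 3 ∷ 3 ∷ [])
         (1 ∷ 2 ∷ 1 ∷ 0 ∷ 0 ∷ [])
  ∷ plan (4 ∷ 1 ∷ []) (3 ∷ []) []
         (1 ∷ 2 ∷ 2 ∷ 1 ∷ 0 ∷ 0 ∷ 1 ∷ 0 ∷ 2 ∷ 2 ∷ 1 ∷ 2 ∷ 1 ∷ 2 ∷ 3 ∷ 3 ∷ 3 ∷ 3 ∷ 3 ∷ 3 ∷ [])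
         (1 ∷ 2 ∷ 2 ∷ 1 ∷ 0 ∷ 0 ∷ [])
  ∷ plan (4 ∷ 0 ∷ []) (3 ∷ []) []
         (1 ∷ 2 ∷ 2 ∷ 1 ∷ 0 ∷ 0 ∷ 1 ∷ 0 ∷ 2 ∷ 2 ∷ 1 ∷ 2 ∷ 1 ∷ 2 ∷ 3 ∷ 3 ∷ 3 ∷ 3 ∷ 3 ∷ 3 ∷ [])
         (1 ∷ 2 ∷ 2 ∷ 1 ∷ 0 ∷ 0 ∷ [])
  ∷ plan (1 ∷ []) (0 ∷ []) (3 ∷ [])
         (1 ∷ 0 ∷ 0 ∷ 1 ∷ 0 ∷ 2 ∷ 2 ∷ 2 ∷ 1 ∷ 2 ∷ 1 ∷ 2 ∷ 3 ∷ 3 ∷ 3 ∷ 3 ∷ 3 ∷ 3 ∷ [])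
         (1 ∷ 0 ∷ 0 ∷ [])
  ∷ plan (4 ∷ 3 ∷ 0 ∷ []) (6 ∷ 5 ∷ []) []
         (2 ∷ 2 ∷ 1 ∷ 2 ∷ 1 ∷ 2 ∷ 1 ∷ 0 ∷ 0 ∷ 1 ∷ 0 ∷ 2 ∷ 2 ∷ 1 ∷ 2 ∷ 1 ∷ 2 ∷ 3 ∷ 3 ∷ 3 ∷ 3 ∷ 3 ∷ 3 ∷ 3 ∷ 3 ∷ [])
         (2 ∷ 2 ∷ 1 ∷ 2 ∷ 1 ∷ 2 ∷ 1 ∷ 0 ∷ 0 ∷ [])
  ∷ plan (1 ∷ []) (0 ∷ []) (3 ∷ 5 ∷ 6 ∷ [])
         (1 ∷ 0 ∷ 0 ∷ 1 ∷ 0 ∷ 2 ∷ 2 ∷ 2 ∷ 1 ∷ 2 ∷ 1 ∷ 2 ∷ 3 ∷ 3 ∷ 3 ∷ 3 ∷ 3 ∷ 3 ∷ 3 ∷ 3 ∷ [])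
         (1 ∷ 0 ∷ 0 ∷ [])
  ∷ plan (4 ∷ 3 ∷ 0 ∷ []) (6 ∷ 5 ∷ []) (7 ∷ 8 ∷ [])
         (2 ∷ 2 ∷ 1 ∷ 2 ∷ 1 ∷ 2 ∷ 1 ∷ 0 ∷ 0 ∷ 1 ∷ 0 ∷ 2 ∷ 2 ∷ 1 ∷ 2 ∷ 1 ∷ 2 ∷ 3 ∷ 3 ∷ 3 ∷ 3 ∷ 3 ∷ 3 ∷ 3 ∷ 3 ∷ [])
         (2 ∷ 2 ∷ 1 ∷ 2 ∷ 1 ∷ 2 ∷ 1 ∷ 0 ∷ 0 ∷ [])
  ∷ plan (1 ∷ []) (0 ∷ []) (3 ∷ 5 ∷ 6 ∷ 7 ∷ 8 ∷ [])
         (1 ∷ 0 ∷ 0 ∷ 1 ∷ 0 ∷ 2 ∷ 2 ∷ 2 ∷ 1 ∷ 2 ∷ 1 ∷ 2 ∷ 3 ∷ 3 ∷ 3 ∷ 3 ∷ 3 ∷ 3 ∷ 3 ∷ 3 ∷ [])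
         (1 ∷ 0 ∷ 0 ∷ [])
  ∷ plan (4 ∷ 1 ∷ []) (3 ∷ 0 ∷ []) (5 ∷ 7 ∷ 8 ∷ [])
         (1 ∷ 2 ∷ 2 ∷ 1 ∷ 0 ∷ 0 ∷ 1 ∷ 0 ∷ 2 ∷ 2 ∷ 2 ∷ 1 ∷ 2 ∷ 1 ∷ 2 ∷ 3 ∷ 3 ∷ 3 ∷ 3 ∷ 3 ∷ 3 ∷ 3 ∷ 3 ∷ [])
         (1 ∷ 2 ∷ 2 ∷ 1 ∷ 0 ∷ 0 ∷ [])
  ∷ plan (4 ∷ 1 ∷ []) (3 ∷ 0 ∷ []) (5 ∷ 6 ∷ 7 ∷ [])
         (1 ∷ 2 ∷ 2 ∷ 1 ∷ 0 ∷ 0 ∷ 1 ∷ 0 ∷ 2 ∷ 2 ∷ 2 ∷ 1 ∷ 2 ∷ 1 ∷ 2 ∷ 3 ∷ 3 ∷ 3 ∷ 3 ∷ 3 ∷ 3 ∷ 3 ∷ 3 ∷ 3 ∷ [])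
         (1 ∷ 2 ∷ 2 ∷ 1 ∷ 0 ∷ 0 ∷ [])
  ∷ plan (4 ∷ 1 ∷ []) (3 ∷ 0 ∷ []) (5 ∷ 6 ∷ 7 ∷ 8 ∷ [])
         (1 ∷ 2 ∷ 2 ∷ 1 ∷ 0 ∷ 0 ∷ 1 ∷ 0 ∷ 2 ∷ 2 ∷ 2 ∷ 1 ∷ 2 ∷ 1 ∷ 2 ∷ 3 ∷ 3 ∷ 3 ∷ 3 ∷ 3 ∷ 3 ∷ 3 ∷ 3 ∷ 3 ∷ [])
         (1 ∷ 2 ∷ 2 ∷ 1 ∷ 0 ∷ 0 ∷ [])
  ∷ plan (4 ∷ 1 ∷ []) (0 ∷ []) (5 ∷ 6 ∷ 7 ∷ 8 ∷ [])
         (1 ∷ 2 ∷ 1 ∷ 0 ∷ 0 ∷ 1 ∷ 0 ∷ 2 ∷ 2 ∷ 2 ∷ 1 ∷ 2 ∷ 1 ∷ 2 ∷ 3 ∷ 3 ∷ 3 ∷ 3 ∷ 3 ∷ 3 ∷ 3 ∷ 3 ∷ [])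
         (1 ∷ 2 ∷ 1 ∷ 0 ∷ 0 ∷ [])
  ∷ plan (4 ∷ 1 ∷ []) (3 ∷ 0 ∷ []) (6 ∷ 7 ∷ 8 ∷ [])
         (1 ∷ 2 ∷ 2 ∷ 1 ∷ 0 ∷ 0 ∷ 1 ∷ 0 ∷ 2 ∷ 2 ∷ 2 ∷ 1 ∷ 2 ∷ 1 ∷ 2 ∷ 3 ∷ 3 ∷ 3 ∷ 3 ∷ 3 ∷ 3 ∷ 3 ∷ 3 ∷ [])
         (1 ∷ 2 ∷ 2 ∷ 1 ∷ 0 ∷ 0 ∷ [])
  ∷ plan (4 ∷ 1 ∷ []) (3 ∷ 0 ∷ []) (5 ∷ 6 ∷ 8 ∷ [])
         (1 ∷ 2 ∷ 2 ∷ 1 ∷ 0 ∷ 0 ∷ 1 ∷ 0 ∷ 2 ∷ 2 ∷ 2 ∷ 1 ∷ 2 ∷ 1 ∷ 2 ∷ 3 ∷ 3 ∷ 3 ∷ 3 ∷ 3 ∷ 3 ∷ 3 ∷ 3 ∷ 3 ∷ [])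
         (1 ∷ 2 ∷ 2 ∷ 1 ∷ 0 ∷ 0 ∷ [])
  ∷ plan (4 ∷ 1 ∷ []) (3 ∷ 0 ∷ []) (5 ∷ [])
         (1 ∷ 2 ∷ 2 ∷ 1 ∷ 0 ∷ 0 ∷ 1 ∷ 0 ∷ 2 ∷ 2 ∷ 2 ∷ 1 ∷ 2 ∷ 1 ∷ 2 ∷ 3 ∷ 3 ∷ 3 ∷ 3 ∷ 3 ∷ 3 ∷ 3 ∷ 3 ∷ [])
         (1 ∷ 2 ∷ 2 ∷ 1 ∷ 0 ∷ 0 ∷ [])
  ∷ plan (4 ∷ 1 ∷ []) (0 ∷ []) (5 ∷ 6 ∷ [])
         (1 ∷ 2 ∷ 1 ∷ 0 ∷ 0 ∷ 1 ∷ 0 ∷ 2 ∷ 2 ∷ 2 ∷ 1 ∷ 2 ∷ 1 ∷ 2 ∷ 3 ∷ 3 ∷ 3 ∷ 3 ∷ 3 ∷ 3 ∷ 3 ∷ 3 ∷ [])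
         (1 ∷ 2 ∷ 1 ∷ 0 ∷ 0 ∷ [])
  ∷ plan (4 ∷ 1 ∷ []) (3 ∷ []) (5 ∷ 6 ∷ [])
         (1 ∷ 2 ∷ 2 ∷ 1 ∷ 0 ∷ 0 ∷ 1 ∷ 0 ∷ 2 ∷ 2 ∷ 1 ∷ 2 ∷ 1 ∷ 2 ∷ 3 ∷ 3 ∷ 3 ∷ 3 ∷ 3 ∷ 3 ∷ 3 ∷ 3 ∷ [])
         (1 ∷ 2 ∷ 2 ∷ 1 ∷ 0 ∷ 0 ∷ [])
  ∷ plan (4 ∷ 1 ∷ []) (3 ∷ []) (5 ∷ 6 ∷ 7 ∷ 8 ∷ [])
         (1 ∷ 2 ∷ 2 ∷ 1 ∷ 0 ∷ 0 ∷ 1 ∷ 0 ∷ 2 ∷ 2 ∷ 1 ∷ 2 ∷ 1 ∷ 2 ∷ 3 ∷ 3 ∷ 3 ∷ 3 ∷ 3 ∷ 3 ∷ 3 ∷ 3 ∷ [])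
         (1 ∷ 2 ∷ 2 ∷ 1 ∷ 0 ∷ 0 ∷ [])
  ∷ plan (4 ∷ 1 ∷ []) (3 ∷ 0 ∷ []) (6 ∷ [])
         (1 ∷ 2 ∷ 2 ∷ 1 ∷ 0 ∷ 0 ∷ 1 ∷ 0 ∷ 2 ∷ 2 ∷ 2 ∷ 1 ∷ 2 ∷ 1 ∷ 2 ∷ 3 ∷ 3 ∷ 3 ∷ 3 ∷ 3 ∷ 3 ∷ 3 ∷ 3 ∷ [])
         (1 ∷ 2 ∷ 2 ∷ 1 ∷ 0 ∷ 0 ∷ [])
  ∷ []

planValid : Plan → Bool
planValid P = ⌊ parkable? (parkedPart (Plan.stackI P)) ⌋
  ∧ (completesᵇ (runEnd (Plan.finishRun P) (toEnd (1 ∷ 5 ∷ 2 ∷ []) (planNode P)))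
  ∧ landsIn planNode mainPlans (runMid (Plan.advanceRun P) (lower (1 ∷ 4 ∷ []) (planNode P))))

mainPlans-valid : T (all planValid mainPlans)
mainPlans-valid = tt

record PlanWorks (P : Plan) : Set where
  open Plan P
  field
    parkable : Parkable (parkedPart stackI)
    finishes : Σ (List ℕ) λ o → runEnd finishRun (toEnd (1 ∷ 5 ∷ 2 ∷ []) (planNode P)) ≡ just (as [] [] [] [] o)
    advances : Σ Plan λ P′ → P′ ∈ mainPlans × runMid advanceRun (lower (1 ∷ 4 ∷ []) (planNode P)) ≡ just (planNode P′)

plan-works : ∀ {P} → P ∈ mainPlans → PlanWorks P
plan-works {P} P∈ = record
  { parkable = toWitness (proj₁ c₁) ; finishes = completesᵇ-sound _ (proj₁ c₂) ; advances = landsIn-sound planNode mainPlans _ (proj₂ c₂) }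
  where
  c₁ = split ⌊ parkable? (parkedPart (Plan.stackI P)) ⌋ _ (holds planValid mainPlans mainPlans-valid P∈)
  c₂ = split _ _ (proj₂ c₁)

-- Every main plan completes at every level, whatever sorted entries are parked:
-- at level 0 by its finishing run, higher up by descending into another plan.
main-completes : ∀ m {P} → P ∈ mainPlans → ∀ {B} → Parked (bound (suc m)) B →
                 Completes (conc (label m) (tailInput m) B (planNode P))
main-completes zero {plan d1 d2 L fin _} P∈ parked
  with PlanWorks.finishes (plan-works P∈)
... | o , ran = end-completes (1 ∷ 5 ∷ 2 ∷ []) d1 d2 L fin o (PlanWorks.parkable (plan-works P∈)) ran parked
main-completes (suc m) {plan d1 d2 L _ adv} P∈ {B} parked
  with PlanWorks.advances (plan-works P∈)
... | P′ , P′∈ , ran =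
  subst (λ R → Completes (conc (label (suc m)) R B (as [] d1 d2 L []))) (sym (tail-suc m))
    (descend-completes m (1 ∷ 4 ∷ []) (tailInput m) d1 d2 L adv (planNode P′) (PlanWorks.parkable (plan-works P∈)) ran
      (main-completes m P′∈) parked)

-- A plan for stacks while one later entry of the input is deleted: runs
-- finishing at level 0 when the first, second or third entry of 1 5 2 is
-- missing, and runs consuming the next window when its 1 is missing
-- (input 4), its 4 is missing (input 1), or the deletion lies beyond it.
record DeletionPlan : Set where
  constructor deletionPlan
  field
    stack₁ stack₂ stackI : List ℕ
    finishRun₀ finishRun₁ finishRun₂ : List ℕ
    advanceRun₀ advanceRun₁ advanceRunLater : List ℕ

deletionNode : DeletionPlan → AState
deletionNode P = as [] stack₁ stack₂ stackI [] where open DeletionPlan P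

-- Plans for the configurations reached after reading a full window of α(m+1)
-- when a later entry is deleted; closed under advancing past a window.
deletionPlans : List DeletionPlan
deletionPlans =
    deletionPlan (4 ∷ 1 ∷ 0 ∷ []) (3 ∷ []) []
         (1 ∷ 0 ∷ 2 ∷ 2 ∷ 1 ∷ 2 ∷ 1 ∷ 2 ∷ 1 ∷ 0 ∷ 2 ∷ 1 ∷ 2 ∷ 3 ∷ 3 ∷ 3 ∷ 3 ∷ 3 ∷ 3 ∷ [])
         (1 ∷ 2 ∷ 2 ∷ 1 ∷ 2 ∷ 1 ∷ 0 ∷ 0 ∷ 2 ∷ 1 ∷ 2 ∷ 1 ∷ 2 ∷ 3 ∷ 3 ∷ 3 ∷ 3 ∷ 3 ∷ 3 ∷ [])
         (1 ∷ 2 ∷ 2 ∷ 1 ∷ 2 ∷ 1 ∷ 0 ∷ 2 ∷ 1 ∷ 0 ∷ 2 ∷ 1 ∷ 3 ∷ 3 ∷ 3 ∷ 2 ∷ 3 ∷ 3 ∷ 3 ∷ [])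
         (1 ∷ 0 ∷ []) (1 ∷ 2 ∷ 2 ∷ 1 ∷ 2 ∷ 1 ∷ 0 ∷ []) (1 ∷ 2 ∷ 2 ∷ 1 ∷ 0 ∷ 0 ∷ [])
  ∷ deletionPlan (4 ∷ 1 ∷ 0 ∷ []) (3 ∷ []) (5 ∷ 6 ∷ [])
         (1 ∷ 0 ∷ 2 ∷ 2 ∷ 1 ∷ 2 ∷ 1 ∷ 2 ∷ 1 ∷ 0 ∷ 2 ∷ 1 ∷ 2 ∷ 3 ∷ 3 ∷ 3 ∷ 3 ∷ 3 ∷ 3 ∷ 3 ∷ 3 ∷ [])
         (1 ∷ 2 ∷ 2 ∷ 1 ∷ 2 ∷ 1 ∷ 0 ∷ 0 ∷ 2 ∷ 1 ∷ 2 ∷ 1 ∷ 2 ∷ 3 ∷ 3 ∷ 3 ∷ 3 ∷ 3 ∷ 3 ∷ 3 ∷ 3 ∷ [])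
         (1 ∷ 2 ∷ 2 ∷ 1 ∷ 2 ∷ 1 ∷ 0 ∷ 2 ∷ 1 ∷ 0 ∷ 2 ∷ 1 ∷ 3 ∷ 3 ∷ 3 ∷ 2 ∷ 3 ∷ 3 ∷ 3 ∷ 3 ∷ 3 ∷ [])
         (1 ∷ 0 ∷ []) (1 ∷ 2 ∷ 2 ∷ 1 ∷ 2 ∷ 1 ∷ 0 ∷ []) (1 ∷ 2 ∷ 2 ∷ 1 ∷ 0 ∷ 0 ∷ [])
  ∷ deletionPlan (4 ∷ 1 ∷ 0 ∷ []) (3 ∷ []) (5 ∷ 6 ∷ 7 ∷ 8 ∷ [])
         (1 ∷ 0 ∷ 2 ∷ 2 ∷ 1 ∷ 2 ∷ 1 ∷ 2 ∷ 1 ∷ 0 ∷ 2 ∷ 1 ∷ 2 ∷ 3 ∷ 3 ∷ 3 ∷ 3 ∷ 3 ∷ 3 ∷ 3 ∷ 3 ∷ [])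
         (1 ∷ 2 ∷ 2 ∷ 1 ∷ 2 ∷ 1 ∷ 0 ∷ 0 ∷ 2 ∷ 1 ∷ 2 ∷ 1 ∷ 2 ∷ 3 ∷ 3 ∷ 3 ∷ 3 ∷ 3 ∷ 3 ∷ 3 ∷ 3 ∷ [])
         (1 ∷ 2 ∷ 2 ∷ 1 ∷ 2 ∷ 1 ∷ 0 ∷ 2 ∷ 1 ∷ 0 ∷ 2 ∷ 1 ∷ 3 ∷ 3 ∷ 3 ∷ 2 ∷ 3 ∷ 3 ∷ 3 ∷ 3 ∷ 3 ∷ [])
         (1 ∷ 0 ∷ []) (1 ∷ 2 ∷ 2 ∷ 1 ∷ 2 ∷ 1 ∷ 0 ∷ []) (1 ∷ 2 ∷ 2 ∷ 1 ∷ 0 ∷ 0 ∷ [])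
  ∷ []

deletionPlanValid : DeletionPlan → Bool
deletionPlanValid P = ⌊ parkable? (parkedPart stackI) ⌋
  ∧ (completesᵇ (runEnd finishRun₀ (toEnd (5 ∷ 2 ∷ []) (deletionNode P)))
  ∧ (completesᵇ (runEnd finishRun₁ (toEnd (1 ∷ 2 ∷ []) (deletionNode P)))
  ∧ (completesᵇ (runEnd finishRun₂ (toEnd (1 ∷ 5 ∷ []) (deletionNode P)))
  ∧ (landsIn planNode mainPlans (runMid advanceRun₀ (lower (4 ∷ []) (deletionNode P)))
  ∧ (landsIn planNode mainPlans (runMid advanceRun₁ (lower (1 ∷ []) (deletionNode P)))
  ∧ landsIn deletionNode deletionPlans (runMid advanceRunLater (lower (1 ∷ 4 ∷ []) (deletionNode P))))))))
  where open DeletionPlan P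

deletionPlans-valid : T (all deletionPlanValid deletionPlans)
deletionPlans-valid = tt

finishRun : DeletionPlan → Fin 3 → List ℕ
finishRun P 0F = DeletionPlan.finishRun₀ P
finishRun P 1F = DeletionPlan.finishRun₁ P
finishRun P 2F = DeletionPlan.finishRun₂ P

record DeletionPlanWorks (P : DeletionPlan) : Set where
  open DeletionPlan P
  field
    parkable : Parkable (parkedPart stackI)
    finishes : ∀ k → Σ (List ℕ) λ o →
               runEnd (finishRun P k) (toEnd (removeAt (1 ∷ 5 ∷ 2 ∷ []) k) (deletionNode P)) ≡ just (as [] [] [] [] o)
    advances₀ : Σ Plan λ P′ → P′ ∈ mainPlans × runMid advanceRun₀ (lower (4 ∷ []) (deletionNode P)) ≡ just (planNode P′)
    advances₁ : Σ Plan λ P′ → P′ ∈ mainPlans × runMid advanceRun₁ (lower (1 ∷ []) (deletionNode P)) ≡ just (planNode P′)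
    advancesLater : Σ DeletionPlan λ P′ → P′ ∈ deletionPlans ×
                    runMid advanceRunLater (lower (1 ∷ 4 ∷ []) (deletionNode P)) ≡ just (deletionNode P′)

deletion-plan-works : ∀ {P} → P ∈ deletionPlans → DeletionPlanWorks P
deletion-plan-works {P} P∈ = record
  { parkable = toWitness (proj₁ c₁)
  ; finishes = λ { 0F → completesᵇ-sound _ (proj₁ c₂)
                 ; 1F → completesᵇ-sound _ (proj₁ c₃)
                 ; 2F → completesᵇ-sound _ (proj₁ c₄) }
  ; advances₀ = landsIn-sound planNode mainPlans _ (proj₁ c₅)
  ; advances₁ = landsIn-sound planNode mainPlans _ (proj₁ c₆)
  ; advancesLater = landsIn-sound deletionNode deletionPlans _ (proj₂ c₆) }
  where
  c₁ = split ⌊ parkable? (parkedPart (DeletionPlan.stackI P)) ⌋ _ (holds deletionPlanValid deletionPlans deletionPlans-valid P∈)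
  c₂ = split _ _ (proj₂ c₁)
  c₃ = split _ _ (proj₂ c₂)
  c₄ = split _ _ (proj₂ c₃)
  c₅ = split _ _ (proj₂ c₄)
  c₆ = split _ _ (proj₂ c₅)

deleteAt : ℕ → List ℕ → List ℕ
deleteAt i xs = take i xs ++ drop (suc i) xs

-- Every deletion plan completes at every level when the k-th entry of the
-- unread input is deleted: at level 0 by its finishing runs; higher up the
-- deletion either hits the next window (and a main plan takes over) or
-- lies beyond it (and another deletion plan takes over).
deletion-completes : ∀ m {P} → P ∈ deletionPlans → ∀ k {B} → Parked (bound (suc m)) B →
                     Completes (conc (label m) (removeAt (tailInput m) k) B (deletionNode P))
deletion-completes zero {P@(deletionPlan d1 d2 L _ _ _ _ _ _)} P∈ k parked
  with DeletionPlanWorks.finishes (deletion-plan-works P∈) k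
... | o , ran = end-completes (removeAt (1 ∷ 5 ∷ 2 ∷ []) k) d1 d2 L (finishRun P k) o
                  (DeletionPlanWorks.parkable (deletion-plan-works P∈)) ran parked
deletion-completes (suc m) {deletionPlan d1 d2 L _ _ _ adv _ _} P∈ 0F parked
  with DeletionPlanWorks.advances₀ (deletion-plan-works P∈)
... | P′ , P′∈ , ran = descend-completes m (4 ∷ []) (tailInput m) d1 d2 L adv (planNode P′)
                         (DeletionPlanWorks.parkable (deletion-plan-works P∈)) ran (main-completes m P′∈) parked
deletion-completes (suc m) {deletionPlan d1 d2 L _ _ _ _ adv _} P∈ 1F {B} parked
  with DeletionPlanWorks.advances₁ (deletion-plan-works P∈)
... | P′ , P′∈ , ran =
  subst (λ R → Completes (conc (label (suc m)) R B (as [] d1 d2 L []))) (sym (cong (deleteAt 1) (tail-suc m)))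
    (descend-completes m (1 ∷ []) (tailInput m) d1 d2 L adv (planNode P′)
      (DeletionPlanWorks.parkable (deletion-plan-works P∈)) ran (main-completes m P′∈) parked)
deletion-completes (suc m) {deletionPlan d1 d2 L _ _ _ _ _ adv} P∈ (Fin.suc (Fin.suc k)) {B} parked
  with DeletionPlanWorks.advancesLater (deletion-plan-works P∈)
... | P′ , P′∈ , ran =
  subst (λ R → Completes (conc (label (suc m)) R B (as [] d1 d2 L [])))
    (sym (cong (λ xs → take 2 xs ++ removeAt (tailInput m) k) (tail-suc m)))
    (descend-completes m (1 ∷ 4 ∷ []) (removeAt (tailInput m) k) d1 d2 L adv (deletionNode P′)
      (DeletionPlanWorks.parkable (deletion-plan-works P∈)) ran (deletion-completes m P′∈ k) parked)

-- Runs from the empty machine through the first window 3 0 1 4 of α(m+1),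
-- with its k-th letter deleted, into a main plan ...
startRun : Fin 4 → List ℕ
startRun 0F = 0 ∷ 1 ∷ 0 ∷ 0 ∷ []
startRun 1F = 0 ∷ 1 ∷ 0 ∷ 0 ∷ []
startRun 2F = 0 ∷ 1 ∷ 0 ∷ 0 ∷ []
startRun 3F = 0 ∷ 1 ∷ 0 ∷ 2 ∷ 1 ∷ 0 ∷ []

start-lands : ∀ k → T (landsIn planNode mainPlans (runMid (startRun k) (as (removeAt (3 ∷ 0 ∷ 1 ∷ 4 ∷ []) k) [] [] [] [])))
start-lands 0F = tt
start-lands 1F = tt
start-lands 2F = tt
start-lands 3F = tt

-- ... and, when a later entry is deleted, through the whole window into a
-- deletion plan.
startRunLater : List ℕ
startRunLater = 0 ∷ 1 ∷ 0 ∷ 0 ∷ 0 ∷ []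

start-later-lands : T (landsIn deletionNode deletionPlans (runMid startRunLater (as (3 ∷ 0 ∷ 1 ∷ 4 ∷ []) [] [] [] [])))
start-later-lands = tt

baseRun : Fin 5 → List ℕ
baseRun 0F = 0 ∷ 1 ∷ 0 ∷ 0 ∷ 1 ∷ 0 ∷ 2 ∷ 2 ∷ 1 ∷ 2 ∷ 1 ∷ 2 ∷ 3 ∷ 3 ∷ 3 ∷ 3 ∷ []
baseRun 1F = 0 ∷ 1 ∷ 0 ∷ 0 ∷ 1 ∷ 0 ∷ 2 ∷ 2 ∷ 1 ∷ 2 ∷ 1 ∷ 2 ∷ 3 ∷ 3 ∷ 3 ∷ 3 ∷ []
baseRun 2F = 0 ∷ 1 ∷ 0 ∷ 0 ∷ 1 ∷ 2 ∷ 2 ∷ 1 ∷ 0 ∷ 2 ∷ 1 ∷ 2 ∷ 3 ∷ 3 ∷ 3 ∷ 3 ∷ []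
baseRun 3F = 0 ∷ 1 ∷ 0 ∷ 2 ∷ 1 ∷ 0 ∷ 0 ∷ 2 ∷ 1 ∷ 2 ∷ 1 ∷ 2 ∷ 3 ∷ 3 ∷ 3 ∷ 3 ∷ []
baseRun 4F = 0 ∷ 1 ∷ 0 ∷ 2 ∷ 1 ∷ 0 ∷ 2 ∷ 1 ∷ 0 ∷ 2 ∷ 1 ∷ 3 ∷ 3 ∷ 3 ∷ 2 ∷ 3 ∷ []

base-completes : ∀ k → T (completesᵇ (runEnd (baseRun k) (as (removeAt (α 0) k) [] [] [] [])))
base-completes 0F = tt
base-completes 1F = tt
base-completes 2F = tt
base-completes 3F = tt
base-completes 4F = tt

window-deleted : ∀ m (k : Fin 4) → StrictlySortable (map (label m) (removeAt (3 ∷ 0 ∷ 1 ∷ 4 ∷ []) k) ++ tailInput m)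
window-deleted m k
  with landsIn-sound planNode mainPlans (runMid (startRun k) (as (removeAt (3 ∷ 0 ∷ 1 ∷ 4 ∷ []) k) [] [] [] [])) (start-lands k)
... | P , P∈ , ran = advance m (tailInput m) (startRun k) _ (planNode P) ran [] (main-completes m P∈ ([] , []))

later-deleted : ∀ m k → StrictlySortable (map (label m) (3 ∷ 0 ∷ 1 ∷ 4 ∷ []) ++ removeAt (tailInput m) k)
later-deleted m k
  with landsIn-sound deletionNode deletionPlans (runMid startRunLater (as (3 ∷ 0 ∷ 1 ∷ 4 ∷ []) [] [] [] [])) start-later-lands
... | P , P∈ , ran = advance m (removeAt (tailInput m) k) startRunLater (as (3 ∷ 0 ∷ 1 ∷ 4 ∷ []) [] [] [] []) (deletionNode P) ran []
                       (deletion-completes m P∈ k ([] , []))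

deletions-sortable : ∀ j (k : Fin (length (α j))) → StrictlySortable (removeAt (α j) k)
deletions-sortable zero k with completesᵇ-sound _ (base-completes k)
... | o , ran = subst Completes (unlabelled (removeAt (α 0) k)) (finish (baseRun k) _ o ran ([] , []))
  where
  unlabelled : ∀ ρ → conc id [] [] (as ρ [] [] [] []) ≡ initial ρ
  unlabelled ρ = cong (λ i → st i [] [] [] []) (trans (++-identityʳ (map id ρ)) (map-id ρ))
deletions-sortable (suc m) 0F = subst StrictlySortable (sym (cong (deleteAt 0) (alpha-suc m))) (window-deleted m 0F)
deletions-sortable (suc m) 1F = subst StrictlySortable (sym (cong (deleteAt 1) (alpha-suc m))) (window-deleted m 1F)
deletions-sortable (suc m) 2F = subst StrictlySortable (sym (cong (deleteAt 2) (alpha-suc m))) (window-deleted m 2F)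
deletions-sortable (suc m) 3F = subst StrictlySortable (sym (cong (deleteAt 3) (alpha-suc m))) (window-deleted m 3F)
deletions-sortable (suc m) (Fin.suc (Fin.suc (Fin.suc (Fin.suc k)))) =
  subst StrictlySortable (sym (cong (λ xs → take 4 xs ++ removeAt (tailInput m) k) (alpha-suc m))) (later-deleted m k)

length-α : ∀ j → length (α j) ≡ 5 + 2 * j
length-α zero    = refl
length-α (suc j) = trans (cong (2 +_) (length-α j)) (cong (5 +_) (sym (*-suc 2 j)))

length-α-injective : ∀ i j → length (α i) ≡ length (α j) → i ≡ j
length-α-injective i j same =
  *-cancelˡ-≡ i j 2 (+-cancelˡ-≡ 5 (2 * i) (2 * j) (trans (sym (length-α i)) (trans same (length-α j))))

theorem1 : ((i j : ℕ) → i ≢ j → ¬ (α i ≼ α j))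
    × ((j : ℕ) → ¬ Sortable₂ (α j))
    × ((j : ℕ) (k : Fin (length (α j))) → Sortable₂ (std (removeAt (α j) k)))
theorem1 = antichain-criterion α length-α-injective unsortable deletions-sortable
         , unsortable
         , λ j k → strict⇒sortable₂ (removeAt (α j) k) (deletions-sortable j k)
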